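{- Let $n>2$ be even and let $q\in\mathcal{B}_n$ be balanced (so $wt(q)=2^{n-1}$). Then no non-linear (balanced) $q$-nearly bent function exists in $\mathcal{B}_n$.
   Context: $V_n=\{0,1\}^n$ (row vectors) and $\mathcal{B}_n$ is the set of Boolean functions $V_n\to\{0,1\}$. $wt(f)=|\{a: f(a)=1\}|$; $f$ is balanced if $wt(f)=2^{n-1}$. "Non-linear" means not affine (algebraic degree at least 2). $W(f,g)=\sum_{a\in V_n}(-1)^{f(a)+g(a)}$. $GL_n$ is the group of invertible $n\times n$ matrices over $\mathbb{F}_2$; $q_A(a)=q(aA)$; $W_q(f)(A)=W(f,q_A)$. $I_q=\sum_{a\in V_n}(-1)^{q(a)}$ and $\rho_q=\left\lceil\left(\frac{2^{2n}-I_q^2}{2^n-1}\right)^{1/2}\right\rceil$. A balanced $f\in\mathcal{B}_n$ is called $q$-nearly bent if $|W_q(f)(A)|\le\rho_q$ for all $A\in GL_n$. -}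

module Defs where

open import Data.Bool using (Bool; true; false; _xor_; _∧_; if_then_else_)
open import Data.Nat using (ℕ; zero; suc; _+_; _*_; _∸_; _^_; _≤ᵇ_)
open import Data.Integer as ℤ using (ℤ; +_; ∣_∣)
open import Data.List using (List; []; _∷_; _++_; map; length; filter; foldr)
open import Data.Vec using (Vec; []; _∷_; replicate; zipWith)
open import Data.Product using (Σ; ∃; _×_; _,_)
open import Relation.Binary.PropositionalEquality using (_≡_)
open import Relation.Nullary using (¬_)

-- V_n = {0,1}^n as row vectors, 0/1 encoded as false/true
V : ℕ → Set
V n = Vec Bool n

BF : ℕ → Set
BF n = V n → Bool

allV : (n : ℕ) → List (V n)
allV zero = [] ∷ []
allV (suc n) = map (false ∷_) (allV n) ++ map (true ∷_) (allV n)

wt : {n : ℕ} → BF n → ℕ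
wt {n} f = length (filter (λ a → f a Data.Bool.≟ true) (allV n))

balanced : {n : ℕ} → BF n → Set
balanced {n} f = wt f ≡ 2 ^ (n ∸ 1)

dot : {n : ℕ} → V n → V n → Bool
dot [] [] = false
dot (x ∷ xs) (y ∷ ys) = (x ∧ y) xor dot xs ys

Affine : {n : ℕ} → BF n → Set
Affine {n} f = Σ (V n) λ a → Σ Bool λ c → ∀ x → f x ≡ (dot a x xor c)

NonLinear : {n : ℕ} → BF n → Set
NonLinear f = ¬ Affine f

-- n×n matrices over F_2, given as a vector of rows
Mat : ℕ → Set
Mat n = Vec (Vec Bool n) n

vadd : {n : ℕ} → V n → V n → V n
vadd = zipWith _xor_

scal : {n : ℕ} → Bool → V n → V n
scal b v = Data.Vec.map (b ∧_) v

vecMat : {m n : ℕ} → Vec Bool m → Vec (Vec Bool n) m → V n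
vecMat {n = n} [] [] = replicate n false
vecMat (a ∷ as) (r ∷ rs) = vadd (scal a r) (vecMat as rs)

matMul : {n : ℕ} → Mat n → Mat n → Mat n
matMul A B = Data.Vec.map (λ r → vecMat r B) A

identity : (n : ℕ) → Mat n
identity zero = []
identity (suc n) = (true ∷ replicate n false) ∷ Data.Vec.map (false ∷_) (identity n)

Invertible : {n : ℕ} → Mat n → Set
Invertible {n} A = Σ (Mat n) λ B → (matMul A B ≡ identity n) × (matMul B A ≡ identity n)

_⟨_⟩ : {n : ℕ} → BF n → Mat n → BF n
(q ⟨ A ⟩) a = q (vecMat a A)

sign : Bool → ℤ
sign false = + 1
sign true = ℤ.- (+ 1)

sumℤ : List ℤ → ℤ
sumℤ = foldr ℤ._+_ (+ 0)

W : {n : ℕ} → BF n → BF n → ℤ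
W {n} f g = sumℤ (map (λ a → sign (f a xor g a)) (allV n))

I : {n : ℕ} → BF n → ℤ
I {n} q = sumℤ (map (λ a → sign (q a)) (allV n))

leastFrom : ℕ → ℕ → ℕ → ℕ → ℕ
leastFrom N D zero r = r
leastFrom N D (suc k) r = if N ≤ᵇ D * r * r then r else leastFrom N D k (suc r)

-- ceilSqrtDiv N D = ⌈ (N / D)^(1/2) ⌉  (for D ≥ 1): the least natural r with D*r² ≥ N.
-- Fuel N suffices since r = N satisfies D*N*N ≥ N when D ≥ 1.
ceilSqrtDiv : ℕ → ℕ → ℕ
ceilSqrtDiv N D = leastFrom N D N 0

-- ρ_q = ⌈ ((2^{2n} - I_q²)/(2^n - 1))^{1/2} ⌉   (note I_q² ≤ 2^{2n}, so ∸ is exact)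
ρ : {n : ℕ} → BF n → ℕ
ρ {n} q = ceilSqrtDiv (2 ^ (2 * n) ∸ ∣ I q ∣ * ∣ I q ∣) (2 ^ n ∸ 1)

NearlyBent : {n : ℕ} → BF n → BF n → Set
NearlyBent {n} q f = balanced f × ((A : Mat n) → Invertible A → ∣ W f (q ⟨ A ⟩) ∣ Data.Nat.≤ ρ q)

-- For balanced q and f the squares of W(f, q_A) have a fixed sum over GL_n:
--   (2^n - 1) ∑_{A ∈ GL_n} W(f, q_A)² = 2^{2n} |GL_n|.
-- Expanding the square, this reduces to the correlation K(x, y) = ∑_A (-1)^{q(xA) + q(yA)}. Using
-- transvections (whose existence follows from a character-sum count), GL_n is transitive on nonzero
-- vectors and on pairs of distinct nonzero vectors, so K takes one value on the diagonal and two
-- off it, K(0, e₁) and K(e₁, e₂); since q is balanced every row sum of K vanishes, which forces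
-- (2^n - 1) K(x, y) = 2^n |GL_n| [x = y] - |GL_n|.
-- So the mean of W(f, q_A)² over GL_n exceeds 2^n. But for n = 2k we have I_q = 0 and ρ_q ≤ 2^k + 1,
-- while W(f, q_A) ≡ 0 (mod 4) and 4 ∣ 2^k; a q-nearly bent f would force W(f, q_A)² ≤ 2^n for all A.

module Submission where

open import Defs
open import Algebra.Bundles using (CommutativeRing; CommutativeMonoid)
open import Data.Bool using (Bool; true; false; _xor_; _∧_)
import Data.Bool.Properties as Bool
open import Data.Bool.Properties
  using (xor-assoc; xor-comm; xor-same; xor-identityˡ; xor-identityʳ; xor-∧-commutativeRing;
         ∧-assoc; ∧-identityʳ; ∧-zeroʳ; ∧-distribˡ-xor; ∧-distribʳ-xor; ∧-commutativeMonoid)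
open import Data.Empty using (⊥-elim)
open import Data.Integer using (ℤ; +_; -[1+_]; _+_; _*_; -_; _-_; _≤_; +≤+; ≢-nonZero; ∣_∣)
import Data.Integer.Properties as ℤ
open import Data.Integer.Tactic.RingSolver using (solve-∀)
import Data.Nat.Tactic.RingSolver as ℕ-Solver
open import Data.List using (List; []; _∷_; _++_; map; length; filter)
import Data.List.Properties as List
import Data.Nat as ℕ
open ℕ using (ℕ; zero; suc; _<_; _^_; z≤n; s≤s)
import Data.Nat.Properties as ℕₚ
open import Data.Nat.Divisibility using (_∣_; divides)
open import Data.Product using (Σ; _×_; _,_; proj₁; proj₂)
open import Data.Sum using (_⊎_; inj₁; inj₂)
open import Data.Vec using (Vec; []; _∷_; replicate)
import Data.Vec as Vec
open import Data.Vec.Properties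
  using (zipWith-comm; zipWith-assoc; zipWith-identityˡ; zipWith-identityʳ; map-id; map-cong; map-∘;
         ≡-dec; ∷-injective)
open import Relation.Binary.Definitions using (DecidableEquality)
open import Relation.Nullary using (¬_; Dec; yes; no)
open import Relation.Binary.PropositionalEquality
open ≡-Reasoning

open import Algebra.Properties.CommutativeSemigroup
  (CommutativeRing.+-commutativeSemigroup xor-∧-commutativeRing)
  using () renaming (interchange to xor-interchange)
open import Algebra.Properties.CommutativeSemigroup
  (CommutativeMonoid.commutativeSemigroup ∧-commutativeMonoid)
  using () renaming (x∙yz≈y∙xz to ∧-swap)

-- Linear algebra over F₂

zeros : (n : ℕ) → V n
zeros n = replicate n false

vadd-comm : ∀ {n} (u v : V n) → vadd u v ≡ vadd v u
vadd-comm = zipWith-comm xor-comm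

vadd-assoc : ∀ {n} (u v w : V n) → vadd (vadd u v) w ≡ vadd u (vadd v w)
vadd-assoc = zipWith-assoc xor-assoc

vadd-identityˡ : ∀ {n} (u : V n) → vadd (zeros n) u ≡ u
vadd-identityˡ = zipWith-identityˡ xor-identityˡ

vadd-identityʳ : ∀ {n} (u : V n) → vadd u (zeros n) ≡ u
vadd-identityʳ = zipWith-identityʳ xor-identityʳ

vadd-self : ∀ {n} (u : V n) → vadd u u ≡ zeros n
vadd-self [] = refl
vadd-self (a ∷ u) = cong₂ _∷_ (xor-same a) (vadd-self u)

vadd-interchange : ∀ {n} (u v w z : V n) → vadd (vadd u v) (vadd w z) ≡ vadd (vadd u w) (vadd v z)
vadd-interchange [] [] [] [] = refl
vadd-interchange (a ∷ u) (b ∷ v) (c ∷ w) (d ∷ z) =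
  cong₂ _∷_ (xor-interchange a b c d) (vadd-interchange u v w z)

vadd-cancelˡ : ∀ {n} (u v : V n) → vadd u (vadd u v) ≡ v
vadd-cancelˡ {n} u v = begin
  vadd u (vadd u v)  ≡⟨ vadd-assoc u u v ⟨
  vadd (vadd u u) v  ≡⟨ cong (λ w → vadd w v) (vadd-self u) ⟩
  vadd (zeros n) v   ≡⟨ vadd-identityˡ v ⟩
  v                  ∎

vadd≡zeros⇒≡ : ∀ {n} (u v : V n) → vadd u v ≡ zeros n → u ≡ v
vadd≡zeros⇒≡ {n} u v u+v≡0 = begin
  u                  ≡⟨ vadd-cancelˡ v u ⟨
  vadd v (vadd v u)  ≡⟨ cong (vadd v) (vadd-comm v u) ⟩
  vadd v (vadd u v)  ≡⟨ cong (vadd v) u+v≡0 ⟩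
  vadd v (zeros n)   ≡⟨ vadd-identityʳ v ⟩
  v                  ∎

scal-true : ∀ {n} (u : V n) → scal true u ≡ u
scal-true = map-id

scal-false : ∀ {n} (u : V n) → scal false u ≡ zeros n
scal-false [] = refl
scal-false (a ∷ u) = cong (false ∷_) (scal-false u)

scal-zeros : ∀ {n} b → scal b (zeros n) ≡ zeros n
scal-zeros {zero} b = refl
scal-zeros {suc n} b = cong₂ _∷_ (∧-zeroʳ b) (scal-zeros b)

scal-distribʳ-xor : ∀ {n} a b (u : V n) → scal (a xor b) u ≡ vadd (scal a u) (scal b u)
scal-distribʳ-xor a b [] = refl
scal-distribʳ-xor a b (x ∷ u) = cong₂ _∷_ (∧-distribʳ-xor x a b) (scal-distribʳ-xor a b u)

scal-distribˡ-vadd : ∀ {n} b (u v : V n) → scal b (vadd u v) ≡ vadd (scal b u) (scal b v)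
scal-distribˡ-vadd b [] [] = refl
scal-distribˡ-vadd b (x ∷ u) (y ∷ v) = cong₂ _∷_ (∧-distribˡ-xor b x y) (scal-distribˡ-vadd b u v)

scal-scal : ∀ {n} a b (u : V n) → scal a (scal b u) ≡ scal (a ∧ b) u
scal-scal a b [] = refl
scal-scal a b (x ∷ u) = cong₂ _∷_ (sym (∧-assoc a b x)) (scal-scal a b u)

dot-zerosʳ : ∀ {n} (c : V n) → dot c (zeros n) ≡ false
dot-zerosʳ [] = refl
dot-zerosʳ (a ∷ c) = cong₂ _xor_ (∧-zeroʳ a) (dot-zerosʳ c)

dot-vaddʳ : ∀ {n} (c u v : V n) → dot c (vadd u v) ≡ dot c u xor dot c v
dot-vaddʳ [] [] [] = refl
dot-vaddʳ (a ∷ c) (x ∷ u) (y ∷ v) =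
  trans (cong₂ _xor_ (∧-distribˡ-xor a x y) (dot-vaddʳ c u v)) (xor-interchange (a ∧ x) (a ∧ y) _ _)

dot-scalʳ : ∀ {n} (c : V n) b (u : V n) → dot c (scal b u) ≡ b ∧ dot c u
dot-scalʳ [] b [] = sym (∧-zeroʳ b)
dot-scalʳ (a ∷ c) b (x ∷ u) =
  trans (cong₂ _xor_ (∧-swap a b x) (dot-scalʳ c b u)) (sym (∧-distribˡ-xor b (a ∧ x) _))

vecMat-zeros : ∀ {m n} (A : Vec (V n) m) → vecMat (zeros m) A ≡ zeros n
vecMat-zeros [] = refl
vecMat-zeros (r ∷ A) = trans (cong₂ vadd (scal-false r) (vecMat-zeros A)) (vadd-identityˡ _)

vecMat-vadd : ∀ {m n} (x y : V m) (A : Vec (V n) m) →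
              vecMat (vadd x y) A ≡ vadd (vecMat x A) (vecMat y A)
vecMat-vadd [] [] [] = sym (vadd-self _)
vecMat-vadd (a ∷ x) (b ∷ y) (r ∷ A) = begin
  vadd (scal (a xor b) r) (vecMat (vadd x y) A)
    ≡⟨ cong₂ vadd (scal-distribʳ-xor a b r) (vecMat-vadd x y A) ⟩
  vadd (vadd (scal a r) (scal b r)) (vadd (vecMat x A) (vecMat y A))
    ≡⟨ vadd-interchange _ _ _ _ ⟩
  vadd (vadd (scal a r) (vecMat x A)) (vadd (scal b r) (vecMat y A)) ∎

vecMat-scal : ∀ {m n} b (x : V m) (A : Vec (V n) m) → vecMat (scal b x) A ≡ scal b (vecMat x A)
vecMat-scal b [] [] = sym (scal-zeros b)
vecMat-scal b (a ∷ x) (r ∷ A) = begin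
  vadd (scal (b ∧ a) r) (vecMat (scal b x) A)     ≡⟨ cong₂ vadd (sym (scal-scal b a r)) (vecMat-scal b x A) ⟩
  vadd (scal b (scal a r)) (scal b (vecMat x A))  ≡⟨ scal-distribˡ-vadd b _ _ ⟨
  scal b (vadd (scal a r) (vecMat x A))           ∎

vecMat-vecMat : ∀ {k m n} (x : V k) (B : Vec (V m) k) (C : Vec (V n) m) →
                vecMat (vecMat x B) C ≡ vecMat x (Vec.map (λ r → vecMat r C) B)
vecMat-vecMat [] [] C = vecMat-zeros C
vecMat-vecMat (a ∷ x) (r ∷ B) C = begin
  vecMat (vadd (scal a r) (vecMat x B)) C
    ≡⟨ vecMat-vadd (scal a r) (vecMat x B) C ⟩
  vadd (vecMat (scal a r) C) (vecMat (vecMat x B) C)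
    ≡⟨ cong₂ vadd (vecMat-scal a r C) (vecMat-vecMat x B C) ⟩
  vadd (scal a (vecMat r C)) (vecMat x (Vec.map (λ r → vecMat r C) B)) ∎

vecMat-matMul : ∀ {n} (x : V n) (B C : Mat n) → vecMat x (matMul B C) ≡ vecMat (vecMat x B) C
vecMat-matMul x B C = sym (vecMat-vecMat x B C)

matMul-assoc : ∀ {n} (A B C : Mat n) → matMul (matMul A B) C ≡ matMul A (matMul B C)
matMul-assoc A B C = trans (sym (map-∘ _ _ A)) (map-cong (λ r → vecMat-vecMat r B C) A)

Additive : ∀ {m n} → (V m → V n) → Set
Additive φ = ∀ u v → φ (vadd u v) ≡ vadd (φ u) (φ v)

additive-zeros : ∀ {m n} (φ : V m → V n) → Additive φ → φ (zeros m) ≡ zeros n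
additive-zeros {m} φ additive = begin
  φ (zeros m)                       ≡⟨ cong φ (vadd-self (zeros m)) ⟨
  φ (vadd (zeros m) (zeros m))      ≡⟨ additive _ _ ⟩
  vadd (φ (zeros m)) (φ (zeros m))  ≡⟨ vadd-self _ ⟩
  zeros _                           ∎

additive-scal : ∀ {m n} (φ : V m → V n) → Additive φ → ∀ b u → φ (scal b u) ≡ scal b (φ u)
additive-scal φ additive true u = trans (cong φ (scal-true u)) (sym (scal-true _))
additive-scal φ additive false u =
  trans (cong φ (scal-false u)) (trans (additive-zeros φ additive) (sym (scal-false _)))

vecMat-map : ∀ {k m n} (φ : V m → V n) → Additive φ → (x : V k) (A : Vec (V m) k) →
             vecMat x (Vec.map φ A) ≡ φ (vecMat x A)
vecMat-map φ additive [] [] = sym (additive-zeros φ additive)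
vecMat-map φ additive (a ∷ x) (r ∷ A) = begin
  vadd (scal a (φ r)) (vecMat x (Vec.map φ A))
    ≡⟨ cong₂ vadd (sym (additive-scal φ additive a r)) (vecMat-map φ additive x A) ⟩
  vadd (φ (scal a r)) (φ (vecMat x A))  ≡⟨ additive _ _ ⟨
  φ (vadd (scal a r) (vecMat x A))      ∎

vecMat-identity : ∀ {n} (x : V n) → vecMat x (identity n) ≡ x
vecMat-identity [] = refl
vecMat-identity {suc n} (a ∷ x) = begin
  vadd ((a ∧ true) ∷ scal a (zeros n)) (vecMat x (Vec.map (false ∷_) (identity n)))
    ≡⟨ cong (vadd _) (vecMat-map (false ∷_) (λ _ _ → refl) x (identity n)) ⟩
  ((a ∧ true) xor false) ∷ vadd (scal a (zeros n)) (vecMat x (identity n))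
    ≡⟨ cong₂ _∷_ (trans (xor-identityʳ _) (∧-identityʳ a)) (cong₂ vadd (scal-zeros a) (vecMat-identity x)) ⟩
  a ∷ vadd (zeros n) x  ≡⟨ cong (a ∷_) (vadd-identityˡ x) ⟩
  a ∷ x                 ∎

map-vecMat-identity : ∀ {m n} (A : Vec (V n) m) → Vec.map (λ r → vecMat r A) (identity m) ≡ A
map-vecMat-identity [] = refl
map-vecMat-identity {suc m} (r ∷ A) = cong₂ _∷_ first-row other-rows
  where
  first-row : vadd (scal true r) (vecMat (zeros m) A) ≡ r
  first-row = trans (cong₂ vadd (scal-true r) (vecMat-zeros A)) (vadd-identityʳ r)
  other-rows : Vec.map (λ z → vecMat z (r ∷ A)) (Vec.map (false ∷_) (identity m)) ≡ A
  other-rows = begin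
    Vec.map (λ z → vecMat z (r ∷ A)) (Vec.map (false ∷_) (identity m))  ≡⟨ map-∘ _ _ (identity m) ⟨
    Vec.map (λ z → vecMat (false ∷ z) (r ∷ A)) (identity m)
      ≡⟨ map-cong (λ z → trans (cong (λ w → vadd w (vecMat z A)) (scal-false r)) (vadd-identityˡ _)) (identity m) ⟩
    Vec.map (λ z → vecMat z A) (identity m)                             ≡⟨ map-vecMat-identity A ⟩
    A                                                                   ∎

matMul-identityˡ : ∀ {n} (A : Mat n) → matMul (identity n) A ≡ A
matMul-identityˡ = map-vecMat-identity

matMul-identityʳ : ∀ {n} (A : Mat n) → matMul A (identity n) ≡ A
matMul-identityʳ A = trans (map-cong vecMat-identity A) (map-id A)

identity-invertible : ∀ n → Invertible (identity n)
identity-invertible n = identity n , matMul-identityˡ _ , matMul-identityˡ _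

inverse-invertible : ∀ {n} {A : Mat n} (A-inv : Invertible A) → Invertible (proj₁ A-inv)
inverse-invertible {A = A} (A′ , AA′≡I , A′A≡I) = A , A′A≡I , AA′≡I

matMul-cancel : ∀ {n} {A B C : Mat n} → matMul A B ≡ identity n → matMul A (matMul B C) ≡ C
matMul-cancel {A = A} {B} {C} AB≡I =
  trans (sym (matMul-assoc A B C)) (trans (cong (λ M → matMul M C) AB≡I) (matMul-identityˡ C))

matMul-invertible : ∀ {n} {A B : Mat n} → Invertible A → Invertible B → Invertible (matMul A B)
matMul-invertible {n} {A} {B} (A′ , AA′≡I , A′A≡I) (B′ , BB′≡I , B′B≡I) =
  matMul B′ A′ , product-inverse AA′≡I BB′≡I , product-inverse B′B≡I A′A≡I
  where
  product-inverse : ∀ {X X′ Y Y′ : Mat n} → matMul X X′ ≡ identity n → matMul Y Y′ ≡ identity n →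
                    matMul (matMul X Y) (matMul Y′ X′) ≡ identity n
  product-inverse {X} {X′} {Y} {Y′} XX′≡I YY′≡I = begin
    matMul (matMul X Y) (matMul Y′ X′)  ≡⟨ matMul-assoc X Y _ ⟩
    matMul X (matMul Y (matMul Y′ X′))  ≡⟨ cong (matMul X) (matMul-cancel YY′≡I) ⟩
    matMul X X′                         ≡⟨ XX′≡I ⟩
    identity n                          ∎

invertible-cancelˡ : ∀ {n} {A B : Mat n} → Invertible B → Invertible (matMul B A) → Invertible A
invertible-cancelˡ {A = A} B-inv BA-inv =
  subst Invertible (matMul-cancel (proj₂ (proj₂ B-inv))) (matMul-invertible (inverse-invertible B-inv) BA-inv)

vecMat-inverse : ∀ {n} {A : Mat n} (A-inv : Invertible A) (x : V n) → vecMat (vecMat x A) (proj₁ A-inv) ≡ x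
vecMat-inverse {A = A} (A′ , AA′≡I , _) x =
  trans (sym (vecMat-matMul x A A′)) (trans (cong (vecMat x) AA′≡I) (vecMat-identity x))

vecMat-injective : ∀ {n} {A : Mat n} → Invertible A → ∀ {x y} → vecMat x A ≡ vecMat y A → x ≡ y
vecMat-injective A-inv {x} {y} xA≡yA =
  trans (sym (vecMat-inverse A-inv x))
        (trans (cong (λ z → vecMat z (proj₁ A-inv)) xA≡yA) (vecMat-inverse A-inv y))

matrixOf : ∀ {n} → (V n → V n) → Mat n
matrixOf {n} φ = Vec.map φ (identity n)

vecMat-matrixOf : ∀ {n} (φ : V n → V n) → Additive φ → (x : V n) → vecMat x (matrixOf φ) ≡ φ x
vecMat-matrixOf φ additive x = trans (vecMat-map φ additive x _) (cong φ (vecMat-identity x))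

matrixOf-involution-invertible : ∀ {n} (φ : V n → V n) → Additive φ → (∀ x → φ (φ x) ≡ x) →
                                 Invertible (matrixOf φ)
matrixOf-involution-invertible {n} φ additive involutive = matrixOf φ , squared≡I , squared≡I
  where
  squared≡I : matMul (matrixOf φ) (matrixOf φ) ≡ identity n
  squared≡I = begin
    Vec.map (λ r → vecMat r (matrixOf φ)) (Vec.map φ (identity n))  ≡⟨ map-∘ _ φ (identity n) ⟨
    Vec.map (λ r → vecMat (φ r) (matrixOf φ)) (identity n)
      ≡⟨ map-cong (λ r → trans (vecMat-matrixOf φ additive (φ r)) (involutive r)) (identity n) ⟩
    Vec.map (λ r → r) (identity n)                                  ≡⟨ map-id _ ⟩
    identity n                                                      ∎

-- Finite sums

∑ : {A : Set} → List A → (A → ℤ) → ℤ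
∑ L f = sumℤ (map f L)

infixr 8 ∑
syntax ∑ L (λ x → e) = ∑[ x ← L ] e

module _ {A : Set} where

  ∑-cong : ∀ (L : List A) {f g : A → ℤ} → (∀ a → f a ≡ g a) → ∑ L f ≡ ∑ L g
  ∑-cong [] f≗g = refl
  ∑-cong (x ∷ L) f≗g = cong₂ _+_ (f≗g x) (∑-cong L f≗g)

  ∑-distrib-+ : ∀ (L : List A) (f g : A → ℤ) → ∑[ a ← L ] (f a + g a) ≡ ∑ L f + ∑ L g
  ∑-distrib-+ [] f g = refl
  ∑-distrib-+ (x ∷ L) f g = trans (cong (_+_ (f x + g x)) (∑-distrib-+ L f g)) (interchange (f x) (g x) _ _)
    where
    interchange : ∀ a b c d → a + b + (c + d) ≡ a + c + (b + d)
    interchange = solve-∀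

  ∑-*ˡ : ∀ (L : List A) (c : ℤ) (f : A → ℤ) → ∑[ a ← L ] (c * f a) ≡ c * ∑ L f
  ∑-*ˡ [] c f = sym (ℤ.*-zeroʳ c)
  ∑-*ˡ (x ∷ L) c f = trans (cong (_+_ (c * f x)) (∑-*ˡ L c f)) (sym (ℤ.*-distribˡ-+ c (f x) _))

  ∑-zero : ∀ (L : List A) → ∑[ a ← L ] + 0 ≡ + 0
  ∑-zero [] = refl
  ∑-zero (x ∷ L) = trans (ℤ.+-identityˡ _) (∑-zero L)

  ∑-const : ∀ (L : List A) c → ∑[ a ← L ] c ≡ c * + length L
  ∑-const [] c = sym (ℤ.*-zeroʳ c)
  ∑-const (x ∷ L) c = trans (cong (_+_ c) (∑-const L c)) (distrib-suc c (+ length L))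
    where
    distrib-suc : ∀ c l → c + c * l ≡ c * (+ 1 + l)
    distrib-suc = solve-∀

  ∑-++ : ∀ (L M : List A) f → ∑ (L ++ M) f ≡ ∑ L f + ∑ M f
  ∑-++ [] M f = sym (ℤ.+-identityˡ _)
  ∑-++ (x ∷ L) M f = trans (cong (_+_ (f x)) (∑-++ L M f)) (sym (ℤ.+-assoc (f x) _ _))

  ∑-mono-≤ : ∀ (L : List A) {f g : A → ℤ} → (∀ a → f a ≤ g a) → ∑ L f ≤ ∑ L g
  ∑-mono-≤ [] f≤g = ℤ.≤-refl
  ∑-mono-≤ (x ∷ L) f≤g = ℤ.+-mono-≤ (f≤g x) (∑-mono-≤ L f≤g)

  ∑≢0⇒∃≢0 : ∀ (L : List A) (f : A → ℤ) → ¬ ∑ L f ≡ + 0 → Σ A λ a → ¬ f a ≡ + 0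
  ∑≢0⇒∃≢0 [] f ∑≢0 = ⊥-elim (∑≢0 refl)
  ∑≢0⇒∃≢0 (x ∷ L) f ∑≢0 with f x ℤ.≟ + 0
  ... | no fx≢0 = x , fx≢0
  ... | yes fx≡0 = ∑≢0⇒∃≢0 L f (λ ∑L≡0 → ∑≢0 (cong₂ _+_ fx≡0 ∑L≡0))

module _ {A B : Set} where

  ∑-map : ∀ (L : List A) (h : A → B) f → ∑ (map h L) f ≡ ∑[ a ← L ] f (h a)
  ∑-map [] h f = refl
  ∑-map (x ∷ L) h f = cong (_+_ (f (h x))) (∑-map L h f)

  ∑-comm : ∀ (L : List A) (M : List B) (f : A → B → ℤ) →
           ∑[ a ← L ] ∑[ b ← M ] f a b ≡ ∑[ b ← M ] ∑[ a ← L ] f a b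
  ∑-comm [] M f = sym (∑-zero M)
  ∑-comm (x ∷ L) M f = begin
    ∑ M (f x) + (∑[ a ← L ] ∑ M (f a))         ≡⟨ cong (_+_ (∑ M (f x))) (∑-comm L M f) ⟩
    ∑ M (f x) + (∑[ b ← M ] ∑[ a ← L ] f a b)  ≡⟨ ∑-distrib-+ M (f x) _ ⟨
    ∑[ b ← M ] (f x b + (∑[ a ← L ] f a b))    ∎

  ∑-*-∑ : ∀ (L : List A) (M : List B) (f : A → ℤ) (g : B → ℤ) →
          ∑ L f * ∑ M g ≡ ∑[ a ← L ] ∑[ b ← M ] (f a * g b)
  ∑-*-∑ L M f g = begin
    ∑ L f * ∑ M g                  ≡⟨ ℤ.*-comm (∑ L f) _ ⟩
    ∑ M g * ∑ L f                  ≡⟨ ∑-*ˡ L (∑ M g) f ⟨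
    ∑[ a ← L ] (∑ M g * f a)
      ≡⟨ ∑-cong L (λ a → trans (ℤ.*-comm (∑ M g) (f a)) (sym (∑-*ˡ M (f a) g))) ⟩
    ∑[ a ← L ] ∑[ b ← M ] (f a * g b) ∎

module KroneckerDelta {A : Set} (_≟_ : DecidableEquality A) where

  δ : A → A → ℤ
  δ a b with a ≟ b
  ... | yes _ = + 1
  ... | no _ = + 0

  δ-refl : ∀ a → δ a a ≡ + 1
  δ-refl a with a ≟ a
  ... | yes _ = refl
  ... | no a≢a = ⊥-elim (a≢a refl)

  δ-≢ : ∀ {a b} → ¬ a ≡ b → δ a b ≡ + 0
  δ-≢ {a} {b} a≢b with a ≟ b
  ... | yes a≡b = ⊥-elim (a≢b a≡b)
  ... | no _ = refl

  δ-sym : ∀ a b → δ a b ≡ δ b a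
  δ-sym a b with b ≟ a
  ... | yes refl = δ-refl a
  ... | no b≢a = δ-≢ (λ a≡b → b≢a (sym a≡b))

  δ-* : ∀ a b (f : A → ℤ) → δ a b * f b ≡ δ a b * f a
  δ-* a b f with a ≟ b
  ... | yes refl = refl
  ... | no _ = refl

  δ≢0⇒≡ : ∀ a b → ¬ δ a b ≡ + 0 → a ≡ b
  δ≢0⇒≡ a b δ≢0 with a ≟ b
  ... | yes a≡b = a≡b
  ... | no _ = ⊥-elim (δ≢0 refl)

  δ-ℕ : ∀ a b → Σ ℕ λ k → δ a b ≡ + k
  δ-ℕ a b with a ≟ b
  ... | yes _ = 1 , refl
  ... | no _ = 0 , refl

  IsEnumeration : List A → Set
  IsEnumeration L = ∀ a → ∑ L (δ a) ≡ + 1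

  module _ {L : List A} (enum : IsEnumeration L) where

    ∑-δ : ∀ a (f : A → ℤ) → ∑[ b ← L ] (δ a b * f b) ≡ f a
    ∑-δ a f = begin
      ∑[ b ← L ] (δ a b * f b)  ≡⟨ ∑-cong L (λ b → trans (δ-* a b f) (ℤ.*-comm (δ a b) (f a))) ⟩
      ∑[ b ← L ] (f a * δ a b)  ≡⟨ ∑-*ˡ L (f a) (δ a) ⟩
      f a * ∑ L (δ a)           ≡⟨ cong (f a *_) (enum a) ⟩
      f a * + 1                 ≡⟨ ℤ.*-identityʳ (f a) ⟩
      f a                       ∎

    ∑-reindex : ∀ (h h′ : A → A) → (∀ a → h′ (h a) ≡ a) → (∀ b → h (h′ b) ≡ b) →
                ∀ (f : A → ℤ) → ∑[ a ← L ] f (h a) ≡ ∑ L f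
    ∑-reindex h h′ h′∘h≗id h∘h′≗id f = begin
      ∑[ a ← L ] f (h a)
        ≡⟨ ∑-cong L (λ a → ∑-δ (h a) f) ⟨
      ∑[ a ← L ] ∑[ b ← L ] (δ (h a) b * f b)
        ≡⟨ ∑-comm L L _ ⟩
      ∑[ b ← L ] ∑[ a ← L ] (δ (h a) b * f b)
        ≡⟨ ∑-cong L (λ b → ∑-cong L (λ a → trans (cong (_* f b) (δ-transpose a b))
                                                  (ℤ.*-comm (δ (h′ b) a) (f b)))) ⟩
      ∑[ b ← L ] ∑[ a ← L ] (f b * δ (h′ b) a)
        ≡⟨ ∑-cong L (λ b → trans (∑-*ˡ L (f b) (δ (h′ b))) (cong (f b *_) (enum (h′ b)))) ⟩
      ∑[ b ← L ] (f b * + 1)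
        ≡⟨ ∑-cong L (λ b → ℤ.*-identityʳ (f b)) ⟩
      ∑ L f ∎
      where
      δ-transpose : ∀ a b → δ (h a) b ≡ δ (h′ b) a
      δ-transpose a b with h a ≟ b | h′ b ≟ a
      ... | yes _ | yes _ = refl
      ... | no _ | no _ = refl
      ... | yes ha≡b | no h′b≢a = ⊥-elim (h′b≢a (trans (cong h′ (sym ha≡b)) (h′∘h≗id a)))
      ... | no ha≢b | yes h′b≡a = ⊥-elim (ha≢b (trans (cong h (sym h′b≡a)) (h∘h′≗id b)))

-- Enumerating vectors and matrices

module _ {A : Set} (_≟_ : DecidableEquality A) {k : ℕ} where
  open KroneckerDelta _≟_ using () renaming (δ to δ₀; δ-refl to δ₀-refl; δ-≢ to δ₀-≢)
  open KroneckerDelta (≡-dec {n = k} _≟_) using () renaming (δ to δ₁; δ-refl to δ₁-refl; δ-≢ to δ₁-≢)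
  open KroneckerDelta (≡-dec {n = suc k} _≟_) using () renaming (δ to δ₂; δ-refl to δ₂-refl; δ-≢ to δ₂-≢)

  δ-∷ : ∀ x y (a b : Vec A k) → δ₂ (x ∷ a) (y ∷ b) ≡ δ₀ x y * δ₁ a b
  δ-∷ x y a b = by-cases (x ≟ y) (≡-dec _≟_ a b)
    where
    by-cases : Dec (x ≡ y) → Dec (a ≡ b) → δ₂ (x ∷ a) (y ∷ b) ≡ δ₀ x y * δ₁ a b
    by-cases (yes refl) (yes refl) = trans (δ₂-refl (x ∷ a)) (sym (cong₂ _*_ (δ₀-refl x) (δ₁-refl a)))
    by-cases (no x≢y) _ =
      trans (δ₂-≢ (λ eq → x≢y (proj₁ (∷-injective eq)))) (cong (_* δ₁ a b) (sym (δ₀-≢ x≢y)))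
    by-cases (yes refl) (no a≢b) =
      trans (δ₂-≢ (λ eq → a≢b (proj₂ (∷-injective eq))))
            (sym (trans (cong (δ₀ x x *_) (δ₁-≢ a≢b)) (ℤ.*-zeroʳ (δ₀ x x))))

module _ {A : Set} where

  consEach : ∀ {k} → List A → List (Vec A k) → List (Vec A (suc k))
  consEach [] M = []
  consEach (y ∷ L) M = map (y ∷_) M ++ consEach L M

  allVec : List A → (k : ℕ) → List (Vec A k)
  allVec L zero = [] ∷ []
  allVec L (suc k) = consEach L (allVec L k)

  ∑-consEach : ∀ {k} (L : List A) (M : List (Vec A k)) f →
               ∑ (consEach L M) f ≡ ∑[ y ← L ] ∑[ v ← M ] f (y ∷ v)
  ∑-consEach [] M f = refl
  ∑-consEach (y ∷ L) M f = begin
    ∑ (map (y ∷_) M ++ consEach L M) f           ≡⟨ ∑-++ (map (y ∷_) M) _ f ⟩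
    ∑ (map (y ∷_) M) f + ∑ (consEach L M) f      ≡⟨ cong₂ _+_ (∑-map M (y ∷_) f) (∑-consEach L M f) ⟩
    (∑[ v ← M ] f (y ∷ v)) + (∑[ y ← L ] ∑[ v ← M ] f (y ∷ v)) ∎

  allVec-enumerates : (_≟_ : DecidableEquality A) (L : List A) → KroneckerDelta.IsEnumeration _≟_ L →
                      ∀ k → KroneckerDelta.IsEnumeration (≡-dec {n = k} _≟_) (allVec L k)
  allVec-enumerates _≟_ L enum zero [] = refl
  allVec-enumerates _≟_ L enum (suc k) (x ∷ a) = begin
    ∑ (consEach L (allVec L k)) (δ₂ (x ∷ a))
      ≡⟨ ∑-consEach L _ _ ⟩
    ∑[ y ← L ] ∑[ v ← allVec L k ] δ₂ (x ∷ a) (y ∷ v)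
      ≡⟨ ∑-cong L (λ y → ∑-cong (allVec L k) (δ-∷ _≟_ x y a)) ⟩
    ∑[ y ← L ] ∑[ v ← allVec L k ] (δ₀ x y * δ₁ a v)
      ≡⟨ ∑-cong L (λ y → ∑-*ˡ (allVec L k) (δ₀ x y) (δ₁ a)) ⟩
    ∑[ y ← L ] (δ₀ x y * ∑ (allVec L k) (δ₁ a))
      ≡⟨ ∑-cong L (λ y → trans (cong (δ₀ x y *_) (allVec-enumerates _≟_ L enum k a))
                               (ℤ.*-identityʳ (δ₀ x y))) ⟩
    ∑ L (δ₀ x)
      ≡⟨ enum x ⟩
    + 1 ∎
    where
    open KroneckerDelta _≟_ using () renaming (δ to δ₀)
    open KroneckerDelta (≡-dec {n = k} _≟_) using () renaming (δ to δ₁)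
    open KroneckerDelta (≡-dec {n = suc k} _≟_) using () renaming (δ to δ₂)

_≟V_ : ∀ {n} → DecidableEquality (V n)
_≟V_ = ≡-dec Bool._≟_

_≟M_ : ∀ {n} → DecidableEquality (Mat n)
_≟M_ = ≡-dec _≟V_

module OnBool = KroneckerDelta Bool._≟_
module OnV {n} = KroneckerDelta (_≟V_ {n})
module OnMat {n} = KroneckerDelta (_≟M_ {n})

allV≡allVec : ∀ n → allV n ≡ allVec (false ∷ true ∷ []) n
allV≡allVec zero = refl
allV≡allVec (suc n) rewrite allV≡allVec n =
  cong (map (false ∷_) (allVec bools n) ++_) (sym (List.++-identityʳ (map (true ∷_) (allVec bools n))))
  where bools = false ∷ true ∷ []

allV-enumerates : ∀ n → OnV.IsEnumeration (allV n)
allV-enumerates n rewrite allV≡allVec n = allVec-enumerates Bool._≟_ (false ∷ true ∷ []) bools n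
  where
  bools : OnBool.IsEnumeration (false ∷ true ∷ [])
  bools false = refl
  bools true = refl

allV-length : ∀ n → length (allV n) ≡ 2 ^ n
allV-length zero = refl
allV-length (suc n) = begin
  length (map (false ∷_) (allV n) ++ map (true ∷_) (allV n))
    ≡⟨ List.length-++ (map (false ∷_) (allV n)) ⟩
  length (map (false ∷_) (allV n)) ℕ.+ length (map (true ∷_) (allV n))
    ≡⟨ cong₂ ℕ._+_ (List.length-map _ (allV n)) (List.length-map _ (allV n)) ⟩
  length (allV n) ℕ.+ length (allV n)
    ≡⟨ cong₂ ℕ._+_ (allV-length n) (trans (allV-length n) (sym (ℕₚ.+-identityʳ _))) ⟩
  2 ^ suc n ∎

allMat : ∀ n → List (Mat n)
allMat n = allVec (allV n) n

allMat-enumerates : ∀ n → OnMat.IsEnumeration (allMat n)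
allMat-enumerates n = allVec-enumerates _≟V_ (allV n) (allV-enumerates n) n

∑-vecMat : ∀ {n} {A : Mat n} → Invertible A → (f : V n → ℤ) →
           ∑[ y ← allV n ] f (vecMat y A) ≡ ∑ (allV n) f
∑-vecMat {n} {A} A-inv =
  OnV.∑-reindex {L = allV n} (allV-enumerates n) (λ y → vecMat y A) (λ y → vecMat y (proj₁ A-inv))
    (vecMat-inverse A-inv) (vecMat-inverse (inverse-invertible A-inv))

-- Sums over GL_n

module _ {n : ℕ} where
  open OnMat

  inverse-unique : ∀ {A B B′ : Mat n} → matMul B A ≡ identity n → matMul A B′ ≡ identity n → B ≡ B′
  inverse-unique {A} {B} {B′} BA≡I AB′≡I = begin
    B                        ≡⟨ matMul-identityʳ B ⟨
    matMul B (identity n)    ≡⟨ cong (matMul B) AB′≡I ⟨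
    matMul B (matMul A B′)   ≡⟨ matMul-assoc B A B′ ⟨
    matMul (matMul B A) B′   ≡⟨ cong (λ M → matMul M B′) BA≡I ⟩
    matMul (identity n) B′   ≡⟨ matMul-identityˡ B′ ⟩
    B′                       ∎

  -- The number of two-sided inverses of A. It is at most one, so this is an indicator of GL_n that,
  -- unlike Invertible, can be computed with.
  𝟙GL : Mat n → ℤ
  𝟙GL A = ∑[ B ← allMat n ] (δ (matMul A B) (identity n) * δ (matMul B A) (identity n))

  𝟙GL-invertible : ∀ {A} → Invertible A → 𝟙GL A ≡ + 1
  𝟙GL-invertible {A} (A′ , AA′≡I , A′A≡I) = trans (∑-cong (allMat n) term≡δ) (allMat-enumerates n A′)
    where
    term≡δ : ∀ B → δ (matMul A B) (identity n) * δ (matMul B A) (identity n) ≡ δ A′ B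
    term≡δ B with matMul A B ≟M identity n | matMul B A ≟M identity n | A′ ≟M B
    ... | yes _ | yes BA≡I | yes _ = refl
    ... | yes _ | yes BA≡I | no A′≢B = ⊥-elim (A′≢B (sym (inverse-unique BA≡I AA′≡I)))
    ... | no AB≢I | _ | yes refl = ⊥-elim (AB≢I AA′≡I)
    ... | _ | no BA≢I | yes refl = ⊥-elim (BA≢I A′A≡I)
    ... | no _ | _ | no _ = refl
    ... | yes _ | no _ | no _ = refl

  𝟙GL-cases : ∀ A → (𝟙GL A ≡ + 0) ⊎ Invertible A
  𝟙GL-cases A with 𝟙GL A ℤ.≟ + 0
  ... | yes 𝟙≡0 = inj₁ 𝟙≡0
  ... | no 𝟙≢0 = inj₂ (inverse-of (∑≢0⇒∃≢0 (allMat n) _ 𝟙≢0))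
    where
    inverse-of : (Σ (Mat n) λ B → ¬ δ (matMul A B) (identity n) * δ (matMul B A) (identity n) ≡ + 0) →
                 Invertible A
    inverse-of (B , term≢0) =
      B , δ≢0⇒≡ _ _ (λ δ≡0 → term≢0 (cong (_* δ (matMul B A) (identity n)) δ≡0)) ,
          δ≢0⇒≡ _ _ (λ δ≡0 → term≢0 (trans (cong (δ (matMul A B) (identity n) *_) δ≡0)
                                           (ℤ.*-zeroʳ (δ (matMul A B) (identity n)))))

  𝟙GL-matMul : ∀ {B} → Invertible B → ∀ A → 𝟙GL (matMul B A) ≡ 𝟙GL A
  𝟙GL-matMul {B} B-inv A with 𝟙GL-cases A | 𝟙GL-cases (matMul B A)
  ... | inj₂ A-inv | _ = trans (𝟙GL-invertible (matMul-invertible B-inv A-inv)) (sym (𝟙GL-invertible A-inv))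
  ... | inj₁ _ | inj₂ BA-inv =
    trans (𝟙GL-invertible BA-inv) (sym (𝟙GL-invertible (invertible-cancelˡ B-inv BA-inv)))
  ... | inj₁ 𝟙A≡0 | inj₁ 𝟙BA≡0 = trans 𝟙BA≡0 (sym 𝟙A≡0)

  ∑GL : (Mat n → ℤ) → ℤ
  ∑GL φ = ∑[ A ← allMat n ] (𝟙GL A * φ A)

  ∑GL-translate : ∀ {B} → Invertible B → ∀ (φ : Mat n → ℤ) → ∑GL (λ A → φ (matMul B A)) ≡ ∑GL φ
  ∑GL-translate {B} B-inv@(B′ , BB′≡I , B′B≡I) φ = begin
    ∑[ A ← allMat n ] (𝟙GL A * φ (matMul B A))
      ≡⟨ ∑-cong (allMat n) (λ A → cong (_* φ (matMul B A)) (𝟙GL-matMul B-inv A)) ⟨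
    ∑[ A ← allMat n ] (𝟙GL (matMul B A) * φ (matMul B A))
      ≡⟨ ∑-reindex {L = allMat n} (allMat-enumerates n) (matMul B) (matMul B′)
                   (λ _ → matMul-cancel B′B≡I) (λ _ → matMul-cancel BB′≡I) (λ A → 𝟙GL A * φ A) ⟩
    ∑GL φ ∎

  ∑GL-cong : ∀ {φ ψ : Mat n → ℤ} → (∀ A → Invertible A → φ A ≡ ψ A) → ∑GL φ ≡ ∑GL ψ
  ∑GL-cong {φ} {ψ} φ≗ψ = ∑-cong (allMat n) term-cong
    where
    term-cong : ∀ A → 𝟙GL A * φ A ≡ 𝟙GL A * ψ A
    term-cong A with 𝟙GL-cases A
    ... | inj₁ 𝟙≡0 = trans (cong (_* φ A) 𝟙≡0) (sym (cong (_* ψ A) 𝟙≡0))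
    ... | inj₂ A-inv = cong (𝟙GL A *_) (φ≗ψ A A-inv)

  ∑GL-mono-≤ : ∀ {φ ψ : Mat n → ℤ} → (∀ A → Invertible A → φ A ≤ ψ A) → ∑GL φ ≤ ∑GL ψ
  ∑GL-mono-≤ {φ} {ψ} φ≤ψ = ∑-mono-≤ (allMat n) term-mono
    where
    term-mono : ∀ A → 𝟙GL A * φ A ≤ 𝟙GL A * ψ A
    term-mono A with 𝟙GL-cases A
    ... | inj₁ 𝟙≡0 rewrite 𝟙≡0 = ℤ.≤-refl
    ... | inj₂ A-inv rewrite 𝟙GL-invertible A-inv = ℤ.*-monoˡ-≤-nonNeg (+ 1) (φ≤ψ A A-inv)

#GL : ℕ → ℤ
#GL n = ∑GL {n} (λ _ → + 1)

#GL-positive : ∀ n → + 1 ≤ #GL n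
#GL-positive n = subst (_≤ #GL n) identity-term (∑-mono-≤ (allMat n) δ≤𝟙GL)
  where
  identity-term : ∑[ A ← allMat n ] (OnMat.δ (identity n) A * (𝟙GL A * + 1)) ≡ + 1
  identity-term = trans (OnMat.∑-δ {L = allMat n} (allMat-enumerates n) (identity n) (λ A → 𝟙GL A * + 1))
                        (cong (_* + 1) (𝟙GL-invertible (identity-invertible n)))
  δ≤𝟙GL : ∀ A → OnMat.δ (identity n) A * (𝟙GL A * + 1) ≤ 𝟙GL A * + 1
  δ≤𝟙GL A with identity n ≟M A | 𝟙GL-cases A
  ... | yes refl | _ = ℤ.≤-reflexive (ℤ.*-identityˡ _)
  ... | no _ | inj₁ 𝟙≡0 rewrite 𝟙≡0 = ℤ.≤-refl
  ... | no _ | inj₂ A-inv rewrite 𝟙GL-invertible A-inv = +≤+ z≤n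

-- Characters and transvections

sign-xor : ∀ a b → sign (a xor b) ≡ sign a * sign b
sign-xor true true = refl
sign-xor true false = refl
sign-xor false true = refl
sign-xor false false = refl

sign-square : ∀ a → sign a * sign a ≡ + 1
sign-square true = refl
sign-square false = refl

2^n*suc≢0 : ∀ n k → + (2 ^ n) * + suc k ≢ + 0
2^n*suc≢0 n k eq = ℕₚ.<-irrefl refl (subst (0 ℕ.<_) 2^n≡0 (ℕₚ.m^n>0 2 n))
  where
  2^n≡0 : 2 ^ n ≡ 0
  2^n≡0 = ℕₚ.m*n≡0⇒m≡0 (2 ^ n) (suc k) (ℤ.+-injective (trans (ℤ.pos-* (2 ^ n) (suc k)) eq))

∑-character : ∀ n (w : V n) → ∑[ c ← allV n ] sign (dot c w) ≡ + (2 ^ n) * OnV.δ w (zeros n)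
∑-character zero [] = refl
∑-character (suc n) (b ∷ w) = begin
  ∑[ c ← map (false ∷_) (allV n) ++ map (true ∷_) (allV n) ] sign (dot c (b ∷ w))
    ≡⟨ ∑-++ (map (false ∷_) (allV n)) (map (true ∷_) (allV n)) _ ⟩
  ∑[ c ← map (false ∷_) (allV n) ] sign (dot c (b ∷ w)) + ∑[ c ← map (true ∷_) (allV n) ] sign (dot c (b ∷ w))
    ≡⟨ cong₂ _+_ (∑-map (allV n) (false ∷_) _) (∑-map (allV n) (true ∷_) _) ⟩
  χ + (∑[ c ← allV n ] sign (b xor dot c w))
    ≡⟨ cong (_+_ χ) (trans (∑-cong (allV n) (λ c → sign-xor b (dot c w))) (∑-*ˡ (allV n) (sign b) _)) ⟩
  χ + sign b * χ
    ≡⟨ cong (λ s → s + sign b * s) (∑-character n w) ⟩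
  P * δ₀ + sign b * (P * δ₀)
    ≡⟨ by-head b ⟩
  + (2 ^ suc n) * OnV.δ (b ∷ w) (zeros (suc n)) ∎
  where
  χ = ∑[ c ← allV n ] sign (dot c w)
  P = + (2 ^ n)
  δ₀ = OnV.δ w (zeros n)
  by-head : ∀ b → P * δ₀ + sign b * (P * δ₀) ≡ + (2 ^ suc n) * OnV.δ (b ∷ w) (zeros (suc n))
  by-head false = begin
    P * δ₀ + + 1 * (P * δ₀)   ≡⟨ double P δ₀ ⟩
    (+ 2 * P) * (+ 1 * δ₀)    ≡⟨ cong₂ _*_ (ℤ.pos-* 2 (2 ^ n)) (δ-∷ Bool._≟_ false false w (zeros n)) ⟨
    + (2 ^ suc n) * OnV.δ (false ∷ w) (zeros (suc n)) ∎
    where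
    double : ∀ P δ₀ → P * δ₀ + + 1 * (P * δ₀) ≡ (+ 2 * P) * (+ 1 * δ₀)
    double = solve-∀
  by-head true = begin
    P * δ₀ + - + 1 * (P * δ₀)   ≡⟨ cancel P δ₀ (+ (2 ^ suc n)) ⟩
    + (2 ^ suc n) * (+ 0 * δ₀)  ≡⟨ cong (+ (2 ^ suc n) *_) (δ-∷ Bool._≟_ true false w (zeros n)) ⟨
    + (2 ^ suc n) * OnV.δ (true ∷ w) (zeros (suc n)) ∎
    where
    cancel : ∀ P δ₀ Q → P * δ₀ + - + 1 * (P * δ₀) ≡ Q * (+ 0 * δ₀)
    cancel = solve-∀

module _ {n : ℕ} where

  𝟙zero : V n → ℤ
  𝟙zero w = OnV.δ w (zeros n)

  WeightedVectors : Set
  WeightedVectors = List (ℤ × V n)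

  characterCombination : WeightedVectors → V n → ℤ
  characterCombination ts c = ∑[ t ← ts ] (proj₁ t * sign (dot c (proj₂ t)))

  ∑-characterCombination : ∀ ts →
    ∑ (allV n) (characterCombination ts) ≡ + (2 ^ n) * ∑[ t ← ts ] (proj₁ t * 𝟙zero (proj₂ t))
  ∑-characterCombination ts = begin
    ∑[ c ← allV n ] ∑[ t ← ts ] (proj₁ t * sign (dot c (proj₂ t)))
      ≡⟨ ∑-comm (allV n) ts _ ⟩
    ∑[ t ← ts ] ∑[ c ← allV n ] (proj₁ t * sign (dot c (proj₂ t)))
      ≡⟨ ∑-cong ts (λ t → ∑-*ˡ (allV n) (proj₁ t) _) ⟩
    ∑[ t ← ts ] (proj₁ t * ∑[ c ← allV n ] sign (dot c (proj₂ t)))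
      ≡⟨ ∑-cong ts (λ t → trans (cong (proj₁ t *_) (∑-character n (proj₂ t)))
                                (swap (proj₁ t) (+ (2 ^ n)) (𝟙zero (proj₂ t)))) ⟩
    ∑[ t ← ts ] (+ (2 ^ n) * (proj₁ t * 𝟙zero (proj₂ t)))
      ≡⟨ ∑-*ˡ ts (+ (2 ^ n)) _ ⟩
    + (2 ^ n) * ∑[ t ← ts ] (proj₁ t * 𝟙zero (proj₂ t)) ∎
    where
    swap : ∀ a P d → a * (P * d) ≡ P * (a * d)
    swap = solve-∀

  ∃-characterCombination≢0 : ∀ ts k → ∑[ t ← ts ] (proj₁ t * 𝟙zero (proj₂ t)) ≡ + suc k →
                             Σ (V n) λ c → characterCombination ts c ≢ + 0
  ∃-characterCombination≢0 ts k weights≡ = ∑≢0⇒∃≢0 (allV n) _ λ ∑≡0 →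
    2^n*suc≢0 n k (trans (sym (trans (∑-characterCombination ts) (cong (+ (2 ^ n) *_) weights≡))) ∑≡0)

  𝟙zero-zeros : 𝟙zero (zeros n) ≡ + 1
  𝟙zero-zeros = OnV.δ-refl (zeros n)

  𝟙zero-≢ : ∀ {w} → w ≢ zeros n → 𝟙zero w ≡ + 0
  𝟙zero-≢ = OnV.δ-≢

  vadd≢zeros : ∀ {u v : V n} → u ≢ v → vadd u v ≢ zeros n
  vadd≢zeros u≢v u+v≡0 = u≢v (vadd≡zeros⇒≡ _ _ u+v≡0)

  -- ∑_c (1 - (-1)^{c·y}) (1 - (-1)^{c·z}) is 4 times the number of such c; expanded into
  -- characters it is 2^n (1 + [y = z]) > 0.
  ∃-functional-11 : ∀ {y z : V n} → y ≢ zeros n → z ≢ zeros n →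
                    Σ (V n) λ c → (dot c y ≡ true) × (dot c z ≡ true)
  ∃-functional-11 {y} {z} y≢0 z≢0 = at-nonvanishing (∃-characterCombination≢0 ts k weights)
    where
    ts : WeightedVectors
    ts = (+ 1 , zeros n) ∷ (- + 1 , y) ∷ (- + 1 , z) ∷ (+ 1 , vadd y z) ∷ []
    k = proj₁ (OnV.δ-ℕ (vadd y z) (zeros n))
    weights : + 1 * 𝟙zero (zeros n) + (- + 1 * 𝟙zero y + (- + 1 * 𝟙zero z + (+ 1 * 𝟙zero (vadd y z) + + 0)))
              ≡ + suc k
    weights rewrite 𝟙zero-zeros | 𝟙zero-≢ y≢0 | 𝟙zero-≢ z≢0 | proj₂ (OnV.δ-ℕ (vadd y z) (zeros n)) =
      arith (+ k)
      where
      arith : ∀ k → + 1 * + 1 + (- + 1 * + 0 + (- + 1 * + 0 + (+ 1 * k + + 0))) ≡ + 1 + k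
      arith = solve-∀
    expand : ∀ p q → + 1 * sign false + (- + 1 * sign p + (- + 1 * sign q + (+ 1 * sign (p xor q) + + 0)))
                     ≡ (+ 1 - sign p) * (+ 1 - sign q)
    expand true true = refl
    expand true false = refl
    expand false true = refl
    expand false false = refl
    pointwise : ∀ c → characterCombination ts c ≡ (+ 1 - sign (dot c y)) * (+ 1 - sign (dot c z))
    pointwise c rewrite dot-zerosʳ c | dot-vaddʳ c y z = expand (dot c y) (dot c z)
    both-true : ∀ p q → (+ 1 - sign p) * (+ 1 - sign q) ≢ + 0 → (p ≡ true) × (q ≡ true)
    both-true true true _ = refl , refl
    both-true true false ≢0 = ⊥-elim (≢0 refl)
    both-true false q ≢0 = ⊥-elim (≢0 refl)
    at-nonvanishing : (Σ (V n) λ c → characterCombination ts c ≢ + 0) →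
                      Σ (V n) λ c → (dot c y ≡ true) × (dot c z ≡ true)
    at-nonvanishing (c , ≢0) = c , both-true (dot c y) (dot c z) (λ ≡0 → ≢0 (trans (pointwise c) ≡0))

  -- As above, with ∑_c (1 + (-1)^{c·u}) (1 - (-1)^{c·y}) (1 - (-1)^{c·v}).
  ∃-functional-011 : ∀ {u y v : V n} → u ≢ zeros n → y ≢ zeros n → v ≢ zeros n → y ≢ u → v ≢ u →
                     Σ (V n) λ c → (dot c u ≡ false) × (dot c y ≡ true) × (dot c v ≡ true)
  ∃-functional-011 {u} {y} {v} u≢0 y≢0 v≢0 y≢u v≢u =
    at-nonvanishing (∃-characterCombination≢0 ts (k ℕ.+ l) weights)
    where
    ts : WeightedVectors
    ts = (+ 1 , zeros n) ∷ (+ 1 , u) ∷ (- + 1 , y) ∷ (- + 1 , v) ∷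
         (+ 1 , vadd y v) ∷ (- + 1 , vadd u y) ∷ (- + 1 , vadd u v) ∷ (+ 1 , vadd u (vadd y v)) ∷ []
    k = proj₁ (OnV.δ-ℕ (vadd y v) (zeros n))
    l = proj₁ (OnV.δ-ℕ (vadd u (vadd y v)) (zeros n))
    weights : + 1 * 𝟙zero (zeros n) + (+ 1 * 𝟙zero u + (- + 1 * 𝟙zero y + (- + 1 * 𝟙zero v +
              (+ 1 * 𝟙zero (vadd y v) + (- + 1 * 𝟙zero (vadd u y) + (- + 1 * 𝟙zero (vadd u v) +
              (+ 1 * 𝟙zero (vadd u (vadd y v)) + + 0)))))))
              ≡ + suc (k ℕ.+ l)
    weights rewrite 𝟙zero-zeros | 𝟙zero-≢ u≢0 | 𝟙zero-≢ y≢0 | 𝟙zero-≢ v≢0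
                  | 𝟙zero-≢ (vadd≢zeros (λ u≡y → y≢u (sym u≡y)))
                  | 𝟙zero-≢ (vadd≢zeros (λ u≡v → v≢u (sym u≡v)))
                  | proj₂ (OnV.δ-ℕ (vadd y v) (zeros n)) | proj₂ (OnV.δ-ℕ (vadd u (vadd y v)) (zeros n))
                  = arith (+ k) (+ l)
      where
      arith : ∀ k l → + 1 * + 1 + (+ 1 * + 0 + (- + 1 * + 0 + (- + 1 * + 0 + (+ 1 * k + (- + 1 * + 0 +
                      (- + 1 * + 0 + (+ 1 * l + + 0))))))) ≡ + 1 + (k + l)
      arith = solve-∀
    expand : ∀ p q r →
      + 1 * sign false + (+ 1 * sign p + (- + 1 * sign q + (- + 1 * sign r + (+ 1 * sign (q xor r) +
      (- + 1 * sign (p xor q) + (- + 1 * sign (p xor r) + (+ 1 * sign (p xor (q xor r)) + + 0)))))))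
      ≡ (+ 1 + sign p) * (+ 1 - sign q) * (+ 1 - sign r)
    expand true true true = refl
    expand true true false = refl
    expand true false true = refl
    expand true false false = refl
    expand false true true = refl
    expand false true false = refl
    expand false false true = refl
    expand false false false = refl
    pointwise : ∀ c → characterCombination ts c
                      ≡ (+ 1 + sign (dot c u)) * (+ 1 - sign (dot c y)) * (+ 1 - sign (dot c v))
    pointwise c rewrite dot-zerosʳ c | dot-vaddʳ c u (vadd y v) | dot-vaddʳ c y v
                      | dot-vaddʳ c u y | dot-vaddʳ c u v =
      expand (dot c u) (dot c y) (dot c v)
    signs : ∀ p q r → (+ 1 + sign p) * (+ 1 - sign q) * (+ 1 - sign r) ≢ + 0 →
            (p ≡ false) × (q ≡ true) × (r ≡ true)
    signs false true true _ = refl , refl , refl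
    signs true q r ≢0 = ⊥-elim (≢0 refl)
    signs false false r ≢0 = ⊥-elim (≢0 refl)
    signs false true false ≢0 = ⊥-elim (≢0 refl)
    at-nonvanishing : (Σ (V n) λ c → characterCombination ts c ≢ + 0) →
                      Σ (V n) λ c → (dot c u ≡ false) × (dot c y ≡ true) × (dot c v ≡ true)
    at-nonvanishing (c , ≢0) =
      c , signs (dot c u) (dot c y) (dot c v) (λ ≡0 → ≢0 (trans (pointwise c) ≡0))

module _ {n : ℕ} where

  transvection : V n → V n → V n → V n
  transvection c d z = vadd z (scal (dot c z) d)

  transvection-additive : ∀ c d → Additive (transvection c d)
  transvection-additive c d u v = begin
    vadd (vadd u v) (scal (dot c (vadd u v)) d)
      ≡⟨ cong (λ b → vadd (vadd u v) (scal b d)) (dot-vaddʳ c u v) ⟩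
    vadd (vadd u v) (scal (dot c u xor dot c v) d)
      ≡⟨ cong (vadd (vadd u v)) (scal-distribʳ-xor (dot c u) (dot c v) d) ⟩
    vadd (vadd u v) (vadd (scal (dot c u) d) (scal (dot c v) d))
      ≡⟨ vadd-interchange u v _ _ ⟩
    vadd (vadd u (scal (dot c u) d)) (vadd v (scal (dot c v) d)) ∎

  transvection-fixes : ∀ c d x → dot c x ≡ false → transvection c d x ≡ x
  transvection-fixes c d x c·x≡0 = begin
    vadd x (scal (dot c x) d)  ≡⟨ cong (λ b → vadd x (scal b d)) c·x≡0 ⟩
    vadd x (scal false d)      ≡⟨ cong (vadd x) (scal-false d) ⟩
    vadd x (zeros n)           ≡⟨ vadd-identityʳ x ⟩
    x                          ∎

  transvection-moves : ∀ c y v → dot c y ≡ true → transvection c (vadd y v) y ≡ v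
  transvection-moves c y v c·y≡1 = begin
    vadd y (scal (dot c y) (vadd y v))  ≡⟨ cong (λ b → vadd y (scal b (vadd y v))) c·y≡1 ⟩
    vadd y (scal true (vadd y v))       ≡⟨ cong (vadd y) (scal-true (vadd y v)) ⟩
    vadd y (vadd y v)                   ≡⟨ vadd-cancelˡ y v ⟩
    v                                   ∎

  transvection-involutive : ∀ c d → dot c d ≡ false → ∀ z → transvection c d (transvection c d z) ≡ z
  transvection-involutive c d c·d≡0 z = begin
    vadd (vadd z s) (scal (dot c (vadd z s)) d)  ≡⟨ cong (λ b → vadd (vadd z s) (scal b d)) c·[z+s]≡c·z ⟩
    vadd (vadd z s) s                            ≡⟨ vadd-assoc z s s ⟩
    vadd z (vadd s s)                            ≡⟨ cong (vadd z) (vadd-self s) ⟩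
    vadd z (zeros n)                             ≡⟨ vadd-identityʳ z ⟩
    z                                            ∎
    where
    s = scal (dot c z) d
    c·[z+s]≡c·z : dot c (vadd z s) ≡ dot c z
    c·[z+s]≡c·z = begin
      dot c (vadd z s)                 ≡⟨ dot-vaddʳ c z s ⟩
      dot c z xor dot c s              ≡⟨ cong (dot c z xor_) (dot-scalʳ c (dot c z) d) ⟩
      dot c z xor (dot c z ∧ dot c d)  ≡⟨ cong (λ b → dot c z xor (dot c z ∧ b)) c·d≡0 ⟩
      dot c z xor (dot c z ∧ false)    ≡⟨ cong (dot c z xor_) (∧-zeroʳ (dot c z)) ⟩
      dot c z xor false                ≡⟨ xor-identityʳ (dot c z) ⟩
      dot c z                          ∎

  transvectionMatrix : V n → V n → Mat n
  transvectionMatrix c d = matrixOf (transvection c d)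

  transvectionMatrix-invertible : ∀ c d → dot c d ≡ false → Invertible (transvectionMatrix c d)
  transvectionMatrix-invertible c d c·d≡0 =
    matrixOf-involution-invertible (transvection c d) (transvection-additive c d)
                                   (transvection-involutive c d c·d≡0)

  vecMat-transvectionMatrix : ∀ c d x → vecMat x (transvectionMatrix c d) ≡ transvection c d x
  vecMat-transvectionMatrix c d = vecMat-matrixOf (transvection c d) (transvection-additive c d)

  c·[y+v]≡0 : ∀ (c y v : V n) → dot c y ≡ true → dot c v ≡ true → dot c (vadd y v) ≡ false
  c·[y+v]≡0 c y v c·y≡1 c·v≡1 = trans (dot-vaddʳ c y v) (cong₂ _xor_ c·y≡1 c·v≡1)

  GL-transitive : ∀ {y z : V n} → y ≢ zeros n → z ≢ zeros n →
                  Σ (Mat n) λ B → Invertible B × (vecMat y B ≡ z)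
  GL-transitive {y} {z} y≢0 z≢0 = from-functional (∃-functional-11 y≢0 z≢0)
    where
    from-functional : (Σ (V n) λ c → (dot c y ≡ true) × (dot c z ≡ true)) →
                      Σ (Mat n) λ B → Invertible B × (vecMat y B ≡ z)
    from-functional (c , c·y≡1 , c·z≡1) =
      transvectionMatrix c (vadd y z) ,
      transvectionMatrix-invertible c (vadd y z) (c·[y+v]≡0 c y z c·y≡1 c·z≡1) ,
      trans (vecMat-transvectionMatrix c (vadd y z) y) (transvection-moves c y z c·y≡1)

  -- Move x to u by some B₁, then move yB₁ to v by a transvection whose functional vanishes at u.
  GL-pairTransitive : ∀ {x y u v : V n} → x ≢ zeros n → y ≢ zeros n → x ≢ y →
                      u ≢ zeros n → v ≢ zeros n → u ≢ v →
                      Σ (Mat n) λ B → Invertible B × (vecMat x B ≡ u) × (vecMat y B ≡ v)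
  GL-pairTransitive {x} {y} {u} {v} x≢0 y≢0 x≢y u≢0 v≢0 u≢v = then-fix-u (GL-transitive x≢0 u≢0)
    where
    then-fix-u : (Σ (Mat n) λ B₁ → Invertible B₁ × (vecMat x B₁ ≡ u)) →
                 Σ (Mat n) λ B → Invertible B × (vecMat x B ≡ u) × (vecMat y B ≡ v)
    then-fix-u (B₁ , B₁-inv , xB₁≡u) =
      correct (∃-functional-011 u≢0 yB₁≢0 v≢0 yB₁≢u (λ v≡u → u≢v (sym v≡u)))
      where
      yB₁≢0 : vecMat y B₁ ≢ zeros n
      yB₁≢0 yB₁≡0 = y≢0 (vecMat-injective B₁-inv (trans yB₁≡0 (sym (vecMat-zeros B₁))))
      yB₁≢u : vecMat y B₁ ≢ u
      yB₁≢u yB₁≡u = x≢y (vecMat-injective B₁-inv (trans xB₁≡u (sym yB₁≡u)))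
      correct : (Σ (V n) λ c → (dot c u ≡ false) × (dot c (vecMat y B₁) ≡ true) × (dot c v ≡ true)) →
                Σ (Mat n) λ B → Invertible B × (vecMat x B ≡ u) × (vecMat y B ≡ v)
      correct (c , c·u≡0 , c·yB₁≡1 , c·v≡1) =
        matMul B₁ T ,
        matMul-invertible B₁-inv
          (transvectionMatrix-invertible c d (c·[y+v]≡0 c (vecMat y B₁) v c·yB₁≡1 c·v≡1)) ,
        moved x u (trans (cong (transvection c d) xB₁≡u) (transvection-fixes c d u c·u≡0)) ,
        moved y v (transvection-moves c (vecMat y B₁) v c·yB₁≡1)
        where
        d = vadd (vecMat y B₁) v
        T = transvectionMatrix c d
        moved : ∀ w w′ → transvection c d (vecMat w B₁) ≡ w′ → vecMat w (matMul B₁ T) ≡ w′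
        moved w w′ eq = trans (vecMat-matMul w B₁ T) (trans (vecMat-transvectionMatrix c d (vecMat w B₁)) eq)

-- The correlation of q over GL_n

module Correlation {m : ℕ} (q : BF (suc (suc m))) (q-balanced : ∑[ a ← allV (suc (suc m)) ] sign (q a) ≡ + 0)
  where

  private
    n = suc (suc m)
    P = + (2 ^ n)
    e₁ e₂ : V n
    e₁ = true ∷ false ∷ zeros m
    e₂ = false ∷ true ∷ zeros m
    e₁≢0 : e₁ ≢ zeros n
    e₁≢0 ()
    e₂≢0 : e₂ ≢ zeros n
    e₂≢0 ()
    e₁≢e₂ : e₁ ≢ e₂
    e₁≢e₂ ()
    open OnV using (δ; δ-refl; δ-≢)

  Q : V n → ℤ
  Q z = sign (q z)

  K : V n → V n → ℤ
  K x y = ∑GL (λ A → Q (vecMat x A) * Q (vecMat y A))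

  K-diagonal : ∀ x → K x x ≡ #GL n
  K-diagonal x = ∑-cong (allMat n) (λ A → cong (𝟙GL A *_) (sign-square (q (vecMat x A))))

  K-sym : ∀ x y → K x y ≡ K y x
  K-sym x y = ∑-cong (allMat n) (λ A → cong (𝟙GL A *_) (ℤ.*-comm (Q (vecMat x A)) _))

  K-invariant : ∀ {B} → Invertible B → ∀ x y → K (vecMat x B) (vecMat y B) ≡ K x y
  K-invariant {B} B-inv x y = begin
    ∑GL (λ A → Q (vecMat (vecMat x B) A) * Q (vecMat (vecMat y B) A))
      ≡⟨ ∑GL-cong (λ A _ → cong₂ _*_ (cong Q (vecMat-matMul x B A)) (cong Q (vecMat-matMul y B A))) ⟨
    ∑GL (λ A → Q (vecMat x (matMul B A)) * Q (vecMat y (matMul B A)))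
      ≡⟨ ∑GL-translate B-inv (λ C → Q (vecMat x C) * Q (vecMat y C)) ⟩
    K x y ∎

  K-rowSum : ∀ x → ∑ (allV n) (K x) ≡ + 0
  K-rowSum x = begin
    ∑[ y ← allV n ] ∑[ A ← allMat n ] (𝟙GL A * (Q (vecMat x A) * Q (vecMat y A)))
      ≡⟨ ∑-comm (allV n) (allMat n) _ ⟩
    ∑[ A ← allMat n ] ∑[ y ← allV n ] (𝟙GL A * (Q (vecMat x A) * Q (vecMat y A)))
      ≡⟨ ∑-cong (allMat n) (λ A → trans (∑-*ˡ (allV n) (𝟙GL A) _)
                                         (cong (𝟙GL A *_) (∑-*ˡ (allV n) (Q (vecMat x A)) (λ y → Q (vecMat y A))))) ⟩
    ∑GL (λ A → Q (vecMat x A) * ∑[ y ← allV n ] Q (vecMat y A))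
      ≡⟨ ∑GL-cong (λ A A-inv → trans (cong (Q (vecMat x A) *_) (trans (∑-vecMat A-inv Q) q-balanced))
                                      (ℤ.*-zeroʳ (Q (vecMat x A)))) ⟩
    ∑GL {n} (λ _ → + 0)
      ≡⟨ ∑-cong (allMat n) (λ A → ℤ.*-zeroʳ (𝟙GL A)) ⟩
    ∑[ A ← allMat n ] + 0
      ≡⟨ ∑-zero (allMat n) ⟩
    + 0 ∎

  K-zeros : ∀ {y} → y ≢ zeros n → K (zeros n) y ≡ K (zeros n) e₁
  K-zeros {y} y≢0 = via (GL-transitive e₁≢0 y≢0)
    where
    via : (Σ (Mat n) λ B → Invertible B × (vecMat e₁ B ≡ y)) → K (zeros n) y ≡ K (zeros n) e₁
    via (B , B-inv , e₁B≡y) = trans (sym (cong₂ K (vecMat-zeros B) e₁B≡y)) (K-invariant B-inv (zeros n) e₁)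

  K-distinct : ∀ {x y} → x ≢ zeros n → y ≢ zeros n → x ≢ y → K x y ≡ K e₁ e₂
  K-distinct {x} {y} x≢0 y≢0 x≢y = via (GL-pairTransitive e₁≢0 e₂≢0 e₁≢e₂ x≢0 y≢0 x≢y)
    where
    via : (Σ (Mat n) λ B → Invertible B × (vecMat e₁ B ≡ x) × (vecMat e₂ B ≡ y)) → K x y ≡ K e₁ e₂
    via (B , B-inv , e₁B≡x , e₂B≡y) = trans (sym (cong₂ K e₁B≡x e₂B≡y)) (K-invariant B-inv e₁ e₂)

  private
    c k g : ℤ
    c = K (zeros n) e₁
    k = K e₁ e₂
    g = #GL n

  K-zeros-pointwise : ∀ y → K (zeros n) y ≡ c + (g - c) * δ y (zeros n)
  K-zeros-pointwise y with y ≟V zeros n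
  ... | yes refl = trans (K-diagonal (zeros n)) (arith c g)
    where
    arith : ∀ c g → g ≡ c + (g - c) * + 1
    arith = solve-∀
  ... | no y≢0 = trans (K-zeros y≢0) (arith c g)
    where
    arith : ∀ c g → c ≡ c + (g - c) * + 0
    arith = solve-∀

  K-e₁-pointwise : ∀ y → K e₁ y ≡ k + (c - k) * δ y (zeros n) + (g - k) * δ y e₁
  K-e₁-pointwise y with y ≟V zeros n | y ≟V e₁
  ... | yes refl | yes ()
  ... | yes refl | no _ = trans (K-sym e₁ (zeros n)) (arith k c g)
    where
    arith : ∀ k c g → c ≡ k + (c - k) * + 1 + (g - k) * + 0
    arith = solve-∀
  ... | no _ | yes refl = trans (K-diagonal e₁) (arith k c g)
    where
    arith : ∀ k c g → g ≡ k + (c - k) * + 0 + (g - k) * + 1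
    arith = solve-∀
  ... | no y≢0 | no y≢e₁ = trans (K-distinct e₁≢0 y≢0 (λ e₁≡y → y≢e₁ (sym e₁≡y))) (arith k c g)
    where
    arith : ∀ k c g → k ≡ k + (c - k) * + 0 + (g - k) * + 0
    arith = solve-∀

  private
    ∑-δ-column : ∀ u → ∑[ y ← allV n ] δ y u ≡ + 1
    ∑-δ-column u = trans (∑-cong (allV n) (λ y → OnV.δ-sym y u)) (allV-enumerates n u)

    ∑-affineδ : ∀ a b u → ∑[ y ← allV n ] (a + b * δ y u) ≡ a * P + b
    ∑-affineδ a b u = begin
      ∑[ y ← allV n ] (a + b * δ y u)
        ≡⟨ ∑-distrib-+ (allV n) (λ _ → a) _ ⟩
      ∑[ y ← allV n ] a + ∑[ y ← allV n ] (b * δ y u)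
        ≡⟨ cong₂ _+_ (∑-const (allV n) a) (∑-*ˡ (allV n) b _) ⟩
      a * + length (allV n) + b * ∑[ y ← allV n ] δ y u
        ≡⟨ cong₂ (λ l s → a * + l + b * s) (allV-length n) (∑-δ-column u) ⟩
      a * P + b * + 1
        ≡⟨ cong (_+_ (a * P)) (ℤ.*-identityʳ b) ⟩
      a * P + b ∎

    rowSum-zeros : c * P + (g - c) ≡ + 0
    rowSum-zeros = begin
      c * P + (g - c)                                     ≡⟨ ∑-affineδ c (g - c) (zeros n) ⟨
      ∑[ y ← allV n ] (c + (g - c) * δ y (zeros n))       ≡⟨ ∑-cong (allV n) K-zeros-pointwise ⟨
      ∑ (allV n) (K (zeros n))                            ≡⟨ K-rowSum (zeros n) ⟩
      + 0                                                 ∎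

    rowSum-e₁ : k * P + (c - k) + (g - k) ≡ + 0
    rowSum-e₁ = begin
      k * P + (c - k) + (g - k)
        ≡⟨ cong₂ _+_ (∑-affineδ k (c - k) (zeros n))
                     (trans (∑-*ˡ (allV n) (g - k) _)
                            (trans (cong ((g - k) *_) (∑-δ-column e₁)) (ℤ.*-identityʳ (g - k)))) ⟨
      ∑[ y ← allV n ] (k + (c - k) * δ y (zeros n)) + ∑[ y ← allV n ] ((g - k) * δ y e₁)
        ≡⟨ ∑-distrib-+ (allV n) _ _ ⟨
      ∑[ y ← allV n ] (k + (c - k) * δ y (zeros n) + (g - k) * δ y e₁)
        ≡⟨ ∑-cong (allV n) K-e₁-pointwise ⟨
      ∑ (allV n) (K e₁)
        ≡⟨ K-rowSum e₁ ⟩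
      + 0 ∎

    P-2≢0 : P - + 2 ≢ + 0
    P-2≢0 P-2≡0 = 4≰2 (subst (4 ℕ.≤_) 2^n≡2 (ℕₚ.^-monoʳ-≤ 2 {2} {n} (s≤s (s≤s z≤n))))
      where
      shift : ∀ P → P ≡ P - + 2 + + 2
      shift = solve-∀
      2^n≡2 : 2 ^ n ≡ 2
      2^n≡2 = ℤ.+-injective (trans (shift P) (cong (_+ + 2) P-2≡0))
      4≰2 : ¬ (4 ℕ.≤ 2)
      4≰2 (s≤s (s≤s ()))

    [P-1]c≡-g : (P - + 1) * c ≡ - g
    [P-1]c≡-g = trans (arith c P g) (trans (cong (_- g) rowSum-zeros) (ℤ.+-identityˡ (- g)))
      where
      arith : ∀ c P g → (P - + 1) * c ≡ (c * P + (g - c)) - g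
      arith = solve-∀

    -- Eliminating c between the two row sums leaves (P - 2) ((P - 1) k + g) = 0.
    [P-1]k≡-g : (P - + 1) * k ≡ - g
    [P-1]k≡-g = trans (arith₁ (P - + 1) k g) (trans (cong (_- g) [P-1]k+g≡0) (ℤ.+-identityˡ (- g)))
      where
      instance
        P-2-nonZero : Data.Integer.NonZero (P - + 2)
        P-2-nonZero = ≢-nonZero P-2≢0
      eliminate : ∀ P k c g → (P - + 2) * ((P - + 1) * k + g)
                              ≡ (P - + 1) * (k * P + (c - k) + (g - k)) - (c * P + (g - c))
      eliminate = solve-∀
      arith₁ : ∀ N k g → N * k ≡ (N * k + g) - g
      arith₁ = solve-∀
      arith₂ : ∀ N → N * + 0 - + 0 ≡ + 0
      arith₂ = solve-∀
      [P-1]k+g≡0 : (P - + 1) * k + g ≡ + 0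
      [P-1]k+g≡0 = ℤ.*-cancelˡ-≡ (P - + 2) _ _ (begin
        (P - + 2) * ((P - + 1) * k + g)
          ≡⟨ eliminate P k c g ⟩
        (P - + 1) * (k * P + (c - k) + (g - k)) - (c * P + (g - c))
          ≡⟨ cong₂ (λ a b → (P - + 1) * a - b) rowSum-e₁ rowSum-zeros ⟩
        (P - + 1) * + 0 - + 0
          ≡⟨ arith₂ (P - + 1) ⟩
        + 0
          ≡⟨ ℤ.*-zeroʳ (P - + 2) ⟨
        (P - + 2) * + 0 ∎)

  K-closedForm : ∀ x y → (P - + 1) * K x y ≡ P * #GL n * δ x y - #GL n
  K-closedForm x y with x ≟V y
  ... | yes refl = trans (cong ((P - + 1) *_) (K-diagonal x)) (arith P g)
    where
    arith : ∀ P g → (P - + 1) * g ≡ P * g * + 1 - g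
    arith = solve-∀
  ... | no x≢y = trans off-diagonal (arith P g)
    where
    arith : ∀ P g → - g ≡ P * g * + 0 - g
    arith = solve-∀
    off-diagonal : (P - + 1) * K x y ≡ - g
    off-diagonal with x ≟V zeros n | y ≟V zeros n
    ... | yes refl | yes refl = ⊥-elim (x≢y refl)
    ... | yes refl | no y≢0 = trans (cong ((P - + 1) *_) (K-zeros y≢0)) [P-1]c≡-g
    ... | no x≢0 | yes refl = trans (cong ((P - + 1) *_) (trans (K-sym x (zeros n)) (K-zeros x≢0))) [P-1]c≡-g
    ... | no x≢0 | no y≢0 = trans (cong ((P - + 1) *_) (K-distinct x≢0 y≢0 x≢y)) [P-1]k≡-g

  module _ (f : BF n) where
    private
      F : V n → ℤ
      F x = sign (f x)

    ∑GL-walsh² : ∑GL (λ A → W f (q ⟨ A ⟩) * W f (q ⟨ A ⟩))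
                 ≡ ∑[ x ← allV n ] ∑[ y ← allV n ] (F x * F y * K x y)
    ∑GL-walsh² = begin
      ∑GL (λ A → W f (q ⟨ A ⟩) * W f (q ⟨ A ⟩))
        ≡⟨ ∑GL-cong (λ A _ → trans (cong₂ _*_ (walsh-expand A) (walsh-expand A))
                                   (∑-*-∑ (allV n) (allV n) (χ A) (χ A))) ⟩
      ∑GL (λ A → ∑[ x ← allV n ] ∑[ y ← allV n ] (χ A x * χ A y))
        ≡⟨ ∑-cong (allMat n) push-in ⟩
      ∑[ A ← allMat n ] ∑[ x ← allV n ] ∑[ y ← allV n ] (𝟙GL A * (χ A x * χ A y))
        ≡⟨ ∑-comm (allMat n) (allV n) _ ⟩
      ∑[ x ← allV n ] ∑[ A ← allMat n ] ∑[ y ← allV n ] (𝟙GL A * (χ A x * χ A y))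
        ≡⟨ ∑-cong (allV n) (λ x → ∑-comm (allMat n) (allV n) _) ⟩
      ∑[ x ← allV n ] ∑[ y ← allV n ] ∑[ A ← allMat n ] (𝟙GL A * (χ A x * χ A y))
        ≡⟨ ∑-cong (allV n) (λ x → ∑-cong (allV n) (λ y → pull-out x y)) ⟩
      ∑[ x ← allV n ] ∑[ y ← allV n ] (F x * F y * K x y) ∎
      where
      χ : Mat n → V n → ℤ
      χ A x = F x * Q (vecMat x A)
      walsh-expand : ∀ A → W f (q ⟨ A ⟩) ≡ ∑ (allV n) (χ A)
      walsh-expand A = ∑-cong (allV n) (λ x → sign-xor (f x) _)
      push-in : ∀ A → 𝟙GL A * ∑[ x ← allV n ] ∑[ y ← allV n ] (χ A x * χ A y)
                      ≡ ∑[ x ← allV n ] ∑[ y ← allV n ] (𝟙GL A * (χ A x * χ A y))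
      push-in A = trans (sym (∑-*ˡ (allV n) (𝟙GL A) (λ x → ∑[ y ← allV n ] (χ A x * χ A y))))
                        (∑-cong (allV n) (λ x → sym (∑-*ˡ (allV n) (𝟙GL A) (λ y → χ A x * χ A y))))
      rearrange : ∀ i a b u v → i * (a * u * (b * v)) ≡ a * b * (i * (u * v))
      rearrange = solve-∀
      pull-out : ∀ x y → ∑[ A ← allMat n ] (𝟙GL A * (χ A x * χ A y)) ≡ F x * F y * K x y
      pull-out x y = trans (∑-cong (allMat n) (λ A → rearrange (𝟙GL A) (F x) (F y) (Q (vecMat x A)) (Q (vecMat y A))))
                           (∑-*ˡ (allMat n) (F x * F y) (λ A → 𝟙GL A * (Q (vecMat x A) * Q (vecMat y A))))

    -- Expanding the square and summing K-closedForm: (P - 1) ∑ W² = P g ∑_x F(x)² - g (∑_x F(x))².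
    walsh-squareSum : ∑ (allV n) F ≡ + 0 →
                      (P - + 1) * ∑GL (λ A → W f (q ⟨ A ⟩) * W f (q ⟨ A ⟩)) ≡ P * P * #GL n
    walsh-squareSum f-balanced = begin
      (P - + 1) * ∑GL (λ A → W f (q ⟨ A ⟩) * W f (q ⟨ A ⟩))
        ≡⟨ cong ((P - + 1) *_) ∑GL-walsh² ⟩
      (P - + 1) * ∑[ x ← allV n ] ∑[ y ← allV n ] (F x * F y * K x y)
        ≡⟨ trans (∑-cong (allV n) (λ x → ∑-*ˡ (allV n) (P - + 1) _)) (∑-*ˡ (allV n) (P - + 1) _) ⟨
      ∑[ x ← allV n ] ∑[ y ← allV n ] ((P - + 1) * (F x * F y * K x y))
        ≡⟨ ∑-cong (allV n) (λ x → ∑-cong (allV n) (λ y → closed-form x y)) ⟩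
      ∑[ x ← allV n ] ∑[ y ← allV n ] (P * g * (δ x y * (F x * F y)) + - g * (F x * F y))
        ≡⟨ ∑-cong (allV n) row ⟩
      ∑[ x ← allV n ] (P * g)
        ≡⟨ ∑-const (allV n) (P * g) ⟩
      P * g * + length (allV n)
        ≡⟨ cong (λ l → P * g * + l) (allV-length n) ⟩
      P * g * P
        ≡⟨ arith₃ P g ⟩
      P * P * g ∎
      where
      arith₁ : ∀ N a b → N * (a * b) ≡ a * (N * b)
      arith₁ = solve-∀
      arith₂ : ∀ a P g d → a * (P * g * d - g) ≡ P * g * (d * a) + - g * a
      arith₂ = solve-∀
      arith₃ : ∀ P g → P * g * P ≡ P * P * g
      arith₃ = solve-∀
      closed-form : ∀ x y → (P - + 1) * (F x * F y * K x y)
                            ≡ P * g * (δ x y * (F x * F y)) + - g * (F x * F y)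
      closed-form x y = trans (arith₁ (P - + 1) (F x * F y) (K x y))
                              (trans (cong (F x * F y *_) (K-closedForm x y)) (arith₂ (F x * F y) P g (δ x y)))
      row : ∀ x → ∑[ y ← allV n ] (P * g * (δ x y * (F x * F y)) + - g * (F x * F y)) ≡ P * g
      row x = begin
        ∑[ y ← allV n ] (P * g * (δ x y * (F x * F y)) + - g * (F x * F y))
          ≡⟨ ∑-distrib-+ (allV n) _ _ ⟩
        ∑[ y ← allV n ] (P * g * (δ x y * (F x * F y))) + ∑[ y ← allV n ] (- g * (F x * F y))
          ≡⟨ cong₂ _+_ (∑-*ˡ (allV n) (P * g) _) (∑-*ˡ (allV n) (- g) _) ⟩
        P * g * (∑[ y ← allV n ] (δ x y * (F x * F y))) + - g * (∑[ y ← allV n ] (F x * F y))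
          ≡⟨ cong₂ (λ a b → P * g * a + - g * b)
                   (trans (OnV.∑-δ {L = allV n} (allV-enumerates n) x (λ y → F x * F y)) (sign-square (f x)))
                   (trans (∑-*ˡ (allV n) (F x) F) (trans (cong (F x *_) f-balanced) (ℤ.*-zeroʳ (F x)))) ⟩
        P * g * + 1 + - g * + 0
          ≡⟨ arith (P * g) g ⟩
        P * g ∎
        where
        arith : ∀ a g → a * + 1 + - g * + 0 ≡ a
        arith = solve-∀

-- The nearly bent bound

leastFrom-≤ : ∀ N D fuel r r′ → N ℕ.≤ D ℕ.* r′ ℕ.* r′ → r ℕ.≤ r′ → r′ ℕ.≤ r ℕ.+ fuel →
              leastFrom N D fuel r ℕ.≤ r′
leastFrom-≤ N D zero r r′ N≤Dr′² r≤r′ r′≤r+0 = r≤r′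
leastFrom-≤ N D (suc fuel) r r′ N≤Dr′² r≤r′ r′≤r+fuel with N ℕ.≤ᵇ D ℕ.* r ℕ.* r in test
... | true = r≤r′
... | false =
  leastFrom-≤ N D fuel (suc r) r′ N≤Dr′² (ℕₚ.≤∧≢⇒< r≤r′ r≢r′)
              (subst (r′ ℕ.≤_) (ℕₚ.+-suc r fuel) r′≤r+fuel)
  where
  r≢r′ : r ≢ r′
  r≢r′ refl = subst Data.Bool.T test (ℕₚ.≤⇒≤ᵇ N≤Dr′²)

ceilSqrtDiv-≤ : ∀ N D r → N ℕ.≤ D ℕ.* r ℕ.* r → r ℕ.≤ N → ceilSqrtDiv N D ℕ.≤ r
ceilSqrtDiv-≤ N D r N≤Dr² r≤N = leastFrom-≤ N D N 0 r N≤Dr² z≤n r≤N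

-- ⌈ (t⁴ / (t² - 1))^{1/2} ⌉ ≤ t + 1, because (t² - 1)(t + 1)² = (t - 1)(t + 1)³ ≥ t⁴ for t ≥ 2.
ceilSqrtDiv-fourthPower : ∀ t → 2 ℕ.≤ t → ceilSqrtDiv (t ℕ.* t ℕ.* (t ℕ.* t)) (t ℕ.* t ℕ.∸ 1) ℕ.≤ suc t
ceilSqrtDiv-fourthPower .(suc (suc s)) (s≤s (s≤s {n = s} z≤n)) =
  ceilSqrtDiv-≤ t⁴ (t² ℕ.∸ 1) (3 ℕ.+ s) t⁴≤[t²-1][t+1]²
    (subst (3 ℕ.+ s ℕ.≤_) (sym (t⁴-expand s)) (ℕₚ.m≤m+n _ _))
  where
  t² = (2 ℕ.+ s) ℕ.* (2 ℕ.+ s)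
  t⁴ = t² ℕ.* t²
  t²-expand : ∀ s → (2 ℕ.+ s) ℕ.* (2 ℕ.+ s) ≡ 1 ℕ.+ (s ℕ.* s ℕ.+ 4 ℕ.* s ℕ.+ 3)
  t²-expand = ℕ-Solver.solve-∀
  product-expand : ∀ s → (s ℕ.* s ℕ.+ 4 ℕ.* s ℕ.+ 3) ℕ.* (3 ℕ.+ s) ℕ.* (3 ℕ.+ s)
                         ≡ (2 ℕ.+ s) ℕ.* (2 ℕ.+ s) ℕ.* ((2 ℕ.+ s) ℕ.* (2 ℕ.+ s))
                           ℕ.+ (2 ℕ.* (s ℕ.* s ℕ.* s) ℕ.+ 12 ℕ.* (s ℕ.* s) ℕ.+ 22 ℕ.* s ℕ.+ 11)
  product-expand = ℕ-Solver.solve-∀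
  t⁴-expand : ∀ s → (2 ℕ.+ s) ℕ.* (2 ℕ.+ s) ℕ.* ((2 ℕ.+ s) ℕ.* (2 ℕ.+ s))
                    ≡ (3 ℕ.+ s) ℕ.+ (s ℕ.* s ℕ.* s ℕ.* s ℕ.+ 8 ℕ.* (s ℕ.* s ℕ.* s)
                                    ℕ.+ 24 ℕ.* (s ℕ.* s) ℕ.+ 31 ℕ.* s ℕ.+ 13)
  t⁴-expand = ℕ-Solver.solve-∀
  t⁴≤[t²-1][t+1]² : t⁴ ℕ.≤ (t² ℕ.∸ 1) ℕ.* (3 ℕ.+ s) ℕ.* (3 ℕ.+ s)
  t⁴≤[t²-1][t+1]² =
    subst (λ d → t⁴ ℕ.≤ d ℕ.* (3 ℕ.+ s) ℕ.* (3 ℕ.+ s)) (sym (cong (ℕ._∸ 1) (t²-expand s)))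
      (subst (t⁴ ℕ.≤_) (sym (product-expand s)) (ℕₚ.m≤m+n _ _))

∑-sign+2*count : ∀ {A : Set} (L : List A) (p : A → Bool) →
                 ∑[ a ← L ] sign (p a) + + 2 * + length (filter (λ a → p a Bool.≟ true) L) ≡ + length L
∑-sign+2*count [] p = refl
∑-sign+2*count (x ∷ L) p with p x
... | true = trans (arith (∑[ a ← L ] sign (p a)) (+ length (filter (λ a → p a Bool.≟ true) L)))
                   (cong (_+_ (+ 1)) (∑-sign+2*count L p))
  where
  arith : ∀ S l → - + 1 + S + + 2 * (+ 1 + l) ≡ + 1 + (S + + 2 * l)
  arith = solve-∀
... | false = trans (arith (∑[ a ← L ] sign (p a)) (+ length (filter (λ a → p a Bool.≟ true) L)))
                    (cong (_+_ (+ 1)) (∑-sign+2*count L p))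
  where
  arith : ∀ S l → + 1 + S + + 2 * l ≡ + 1 + (S + + 2 * l)
  arith = solve-∀

balanced⇒∑sign≡0 : ∀ {n} (f : BF (suc n)) → balanced f → ∑[ a ← allV (suc n) ] sign (f a) ≡ + 0
balanced⇒∑sign≡0 {n} f f-balanced = cancel S (+ (2 ^ n)) (begin
  S + + 2 * + (2 ^ n)   ≡⟨ cong (λ w → S + + 2 * + w) f-balanced ⟨
  S + + 2 * + wt f      ≡⟨ ∑-sign+2*count (allV (suc n)) f ⟩
  + length (allV (suc n)) ≡⟨ cong +_ (allV-length (suc n)) ⟩
  + (2 ℕ.* 2 ^ n)       ≡⟨ ℤ.pos-* 2 (2 ^ n) ⟩
  + 2 * + (2 ^ n)       ∎)
  where
  S = ∑[ a ← allV (suc n) ] sign (f a)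
  cancel : ∀ S c → S + + 2 * c ≡ + 2 * c → S ≡ + 0
  cancel S c eq = trans (shift S c) (trans (cong (_- + 2 * c) eq) (ℤ.+-inverseʳ (+ 2 * c)))
    where
    shift : ∀ S c → S ≡ S + + 2 * c - + 2 * c
    shift = solve-∀

𝟙 : Bool → ℤ
𝟙 true = + 1
𝟙 false = + 0

sign-xor≡ : ∀ a b → sign (a xor b) ≡ sign a + sign b - + 1 + + 4 * 𝟙 (a ∧ b)
sign-xor≡ true true = refl
sign-xor≡ true false = refl
sign-xor≡ false true = refl
sign-xor≡ false false = refl

-- For balanced f and g, W(f, g) = 4 |f ∧ g| - 2^n, and 2^n = 4 · 2^(n-2).
∣W∣≡4* : ∀ {m} (f g : BF (suc (suc m))) →
         ∑[ a ← allV _ ] sign (f a) ≡ + 0 → ∑[ a ← allV _ ] sign (g a) ≡ + 0 →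
         Σ ℕ λ w → ∣ W f g ∣ ≡ 4 ℕ.* w
∣W∣≡4* {m} f g f-balanced g-balanced =
  ∣ T - + (2 ^ m) ∣ , trans (cong ∣_∣ W≡4[T-2^m]) (ℤ.abs-* (+ 4) (T - + (2 ^ m)))
  where
  n = suc (suc m)
  T = ∑[ a ← allV n ] 𝟙 (f a ∧ g a)
  2^n≡4*2^m : + (2 ^ n) ≡ + 4 * + (2 ^ m)
  2^n≡4*2^m = trans (cong +_ (sym (ℕₚ.*-assoc 2 2 (2 ^ m)))) (ℤ.pos-* 4 (2 ^ m))
  W≡4[T-2^m] : W f g ≡ + 4 * (T - + (2 ^ m))
  W≡4[T-2^m] = begin
    ∑[ a ← allV n ] sign (f a xor g a)
      ≡⟨ ∑-cong (allV n) (λ a → sign-xor≡ (f a) (g a)) ⟩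
    ∑[ a ← allV n ] (sign (f a) + sign (g a) - + 1 + + 4 * 𝟙 (f a ∧ g a))
      ≡⟨ ∑-distrib-+ (allV n) _ _ ⟩
    ∑[ a ← allV n ] (sign (f a) + sign (g a) - + 1) + ∑[ a ← allV n ] (+ 4 * 𝟙 (f a ∧ g a))
      ≡⟨ cong₂ _+_ (trans (∑-distrib-+ (allV n) _ _)
                          (cong₂ _+_ (∑-distrib-+ (allV n) _ _) (∑-const (allV n) (- + 1))))
                   (∑-*ˡ (allV n) (+ 4) _) ⟩
    ∑[ a ← allV n ] sign (f a) + ∑[ a ← allV n ] sign (g a) + - + 1 * + length (allV n) + + 4 * T
      ≡⟨ cong₂ (λ s t → s + t + - + 1 * + length (allV n) + + 4 * T) f-balanced g-balanced ⟩
    + 0 + + 0 + - + 1 * + length (allV n) + + 4 * T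
      ≡⟨ cong (λ l → + 0 + + 0 + - + 1 * + l + + 4 * T) (allV-length n) ⟩
    + 0 + + 0 + - + 1 * + (2 ^ n) + + 4 * T
      ≡⟨ cong (λ P → + 0 + + 0 + - + 1 * P + + 4 * T) 2^n≡4*2^m ⟩
    + 0 + + 0 + - + 1 * (+ 4 * + (2 ^ m)) + + 4 * T
      ≡⟨ arith (+ (2 ^ m)) T ⟩
    + 4 * (T - + (2 ^ m)) ∎
    where
    arith : ∀ b T → + 0 + + 0 + - + 1 * (+ 4 * b) + + 4 * T ≡ + 4 * (T - b)
    arith = solve-∀

ρ-balanced : ∀ {n} (q : BF n) → ∑[ a ← allV n ] sign (q a) ≡ + 0 →
             ∀ t → 2 ^ n ≡ t ℕ.* t → 2 ℕ.≤ t → ρ q ℕ.≤ suc t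
ρ-balanced {n} q q-balanced t 2^n≡t² 2≤t = subst (ℕ._≤ suc t) (sym ρ≡) (ceilSqrtDiv-fourthPower t 2≤t)
  where
  2^2n≡t⁴ : 2 ^ (2 ℕ.* n) ≡ t ℕ.* t ℕ.* (t ℕ.* t)
  2^2n≡t⁴ = begin
    2 ^ (n ℕ.+ (n ℕ.+ 0))    ≡⟨ cong (λ k → 2 ^ (n ℕ.+ k)) (ℕₚ.+-identityʳ n) ⟩
    2 ^ (n ℕ.+ n)            ≡⟨ ℕₚ.^-distribˡ-+-* 2 n n ⟩
    2 ^ n ℕ.* 2 ^ n          ≡⟨ cong₂ ℕ._*_ 2^n≡t² 2^n≡t² ⟩
    t ℕ.* t ℕ.* (t ℕ.* t)    ∎
  ρ≡ : ρ q ≡ ceilSqrtDiv (t ℕ.* t ℕ.* (t ℕ.* t)) (t ℕ.* t ℕ.∸ 1)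
  ρ≡ = cong₂ ceilSqrtDiv (trans (cong (λ i → 2 ^ (2 ℕ.* n) ℕ.∸ ∣ i ∣ ℕ.* ∣ i ∣) q-balanced) 2^2n≡t⁴)
                         (cong (ℕ._∸ 1) 2^n≡t²)

4*≤1+4*⇒≤ : ∀ w b → 4 ℕ.* w ℕ.≤ suc (4 ℕ.* b) → w ℕ.≤ b
4*≤1+4*⇒≤ w b 4w≤1+4b = ℕₚ.≤-pred (ℕₚ.*-cancelˡ-< 4 w (suc b) 4w<4+4b)
  where
  4w<4+4b : 4 ℕ.* w ℕ.< 4 ℕ.* suc b
  4w<4+4b = subst (4 ℕ.* w ℕ.<_) (sym (ℕₚ.*-suc 4 b)) (s≤s (ℕₚ.≤-trans 4w≤1+4b (ℕₚ.m≤n+m _ 2)))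

i*i≡∣i∣*∣i∣ : ∀ i → i * i ≡ + (∣ i ∣ ℕ.* ∣ i ∣)
i*i≡∣i∣*∣i∣ (+ k) = sym (ℤ.pos-* k k)
i*i≡∣i∣*∣i∣ -[1+ k ] = refl

-- |W| is a multiple of 4 and at most ρ_q ≤ t + 1, where t = 4b; so |W| ≤ t.
nearlyBent⇒walsh²≤2^n : ∀ {m} (q f : BF (suc (suc m))) b →
                        2 ^ suc (suc m) ≡ 4 ℕ.* b ℕ.* (4 ℕ.* b) → 1 ℕ.≤ b →
                        ∑[ a ← allV _ ] sign (q a) ≡ + 0 → ∑[ a ← allV _ ] sign (f a) ≡ + 0 →
                        (∀ A → Invertible A → ∣ W f (q ⟨ A ⟩) ∣ ℕ.≤ ρ q) →
                        ∀ A → Invertible A → W f (q ⟨ A ⟩) * W f (q ⟨ A ⟩) ≤ + (2 ^ suc (suc m))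
nearlyBent⇒walsh²≤2^n {m} q f b 2^n≡t² 1≤b q-balanced f-balanced W≤ρ A A-inv =
  subst₂ _≤_ (sym (i*i≡∣i∣*∣i∣ (W f (q ⟨ A ⟩)))) (cong +_ (sym 2^n≡t²))
             (+≤+ (ℕₚ.*-mono-≤ ∣W∣≤t ∣W∣≤t))
  where
  t = 4 ℕ.* b
  2≤t : 2 ℕ.≤ t
  2≤t = ℕₚ.≤-trans (s≤s (s≤s z≤n)) (ℕₚ.*-monoʳ-≤ 4 1≤b)
  qA-balanced : ∑[ a ← allV _ ] sign ((q ⟨ A ⟩) a) ≡ + 0
  qA-balanced = trans (∑-vecMat A-inv (λ y → sign (q y))) q-balanced
  ∣W∣≤t : ∣ W f (q ⟨ A ⟩) ∣ ℕ.≤ t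
  ∣W∣≤t with ∣W∣≡4* f (q ⟨ A ⟩) f-balanced qA-balanced
  ... | w , ∣W∣≡4w = subst (ℕ._≤ t) (sym ∣W∣≡4w) (ℕₚ.*-monoʳ-≤ 4 (4*≤1+4*⇒≤ w b 4w≤1+4b))
    where
    4w≤1+4b : 4 ℕ.* w ℕ.≤ suc (4 ℕ.* b)
    4w≤1+4b =
      subst (ℕ._≤ suc t) ∣W∣≡4w (ℕₚ.≤-trans (W≤ρ A A-inv) (ρ-balanced q q-balanced t 2^n≡t² 2≤t))

-- (P - 1) S = P² g means S = P g + P g / (P - 1), strictly above P g.
¬[P-1]S≡P²g∧S≤Pg : ∀ P S g → + 1 ≤ P → + 1 ≤ g → (P - + 1) * S ≡ P * P * g → ¬ (S ≤ P * g)
¬[P-1]S≡P²g∧S≤Pg .(+ suc p) S .(+ suc k) (+≤+ (s≤s {n = p} z≤n)) (+≤+ (s≤s {n = k} z≤n))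
                 [P-1]S≡P²g S≤X =
  X≰0 (subst₂ _≤_ (cancel (+ p * X) X) (cancel (+ p * X) (+ 0)) (ℤ.+-monoʳ-≤ (- (+ p * X)) pX+X≤pX))
  where
  X = + suc p * + suc k
  expand : ∀ a b → a * ((+ 1 + a) * b) + (+ 1 + a) * b ≡ (+ 1 + a) * (+ 1 + a) * b
  expand = solve-∀
  cancel : ∀ a b → - a + (a + b) ≡ b
  cancel = solve-∀
  pX+X≤pX : + p * X + X ≤ + p * X + + 0
  pX+X≤pX = subst₂ _≤_ (trans [P-1]S≡P²g (sym (expand (+ p) (+ suc k)))) (sym (ℤ.+-identityʳ (+ p * X)))
                      (ℤ.*-monoˡ-≤-nonNeg (+ p) S≤X)
  X≰0 : ¬ (X ≤ + 0)
  X≰0 X≤0 with subst (_≤ + 0) (sym (ℤ.pos-* (suc p) (suc k))) X≤0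
  ... | +≤+ ()

¬walsh²≤2^n : ∀ {m} (q f : BF (suc (suc m))) →
              ∑[ a ← allV _ ] sign (q a) ≡ + 0 → ∑[ a ← allV _ ] sign (f a) ≡ + 0 →
              ¬ (∀ A → Invertible A → W f (q ⟨ A ⟩) * W f (q ⟨ A ⟩) ≤ + (2 ^ suc (suc m)))
¬walsh²≤2^n {m} q f q-balanced f-balanced walsh²≤P =
  ¬[P-1]S≡P²g∧S≤Pg P _ (#GL n) 1≤P (#GL-positive n)
    (Correlation.walsh-squareSum q q-balanced f f-balanced)
    (ℤ.≤-trans (∑GL-mono-≤ walsh²≤P) (ℤ.≤-reflexive ∑GL-P))
  where
  n = suc (suc m)
  P = + (2 ^ n)
  1≤P : + 1 ≤ P
  1≤P = +≤+ (ℕₚ.m^n>0 2 n)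
  arith : ∀ i P → i * P ≡ P * (i * + 1)
  arith = solve-∀
  ∑GL-P : ∑GL {n} (λ _ → P) ≡ P * #GL n
  ∑GL-P = trans (∑-cong (allMat n) (λ A → arith (𝟙GL A) P)) (∑-*ˡ (allMat n) P (λ A → 𝟙GL A * + 1))

2^n≡[4b]² : ∀ {n} → 2 < n → 2 ∣ n → Σ ℕ λ b → (2 ^ n ≡ 4 ℕ.* b ℕ.* (4 ℕ.* b)) × (1 ℕ.≤ b)
2^n≡[4b]² {n} 2<n (divides zero refl) with 2<n
... | ()
2^n≡[4b]² {n} 2<n (divides (suc zero) refl) with 2<n
... | s≤s (s≤s ())
2^n≡[4b]² {n} 2<n (divides (suc (suc j)) refl) = 2 ^ j , 2^n≡t² , ℕₚ.m^n>0 2 j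
  where
  k = suc (suc j)
  2^k≡4b : 2 ^ k ≡ 4 ℕ.* 2 ^ j
  2^k≡4b = sym (ℕₚ.*-assoc 2 2 (2 ^ j))
  2^n≡t² : 2 ^ (k ℕ.* 2) ≡ 4 ℕ.* 2 ^ j ℕ.* (4 ℕ.* 2 ^ j)
  2^n≡t² = begin
    2 ^ (k ℕ.* 2)            ≡⟨ ℕₚ.^-*-assoc 2 k 2 ⟨
    (2 ^ k) ^ 2              ≡⟨ cong (2 ^ k ℕ.*_) (ℕₚ.*-identityʳ (2 ^ k)) ⟩
    2 ^ k ℕ.* 2 ^ k          ≡⟨ cong₂ ℕ._*_ 2^k≡4b 2^k≡4b ⟩
    4 ℕ.* 2 ^ j ℕ.* (4 ℕ.* 2 ^ j) ∎

corollary1 : (n : ℕ) → 2 < n → 2 ∣ n → (q : BF n) → balanced q →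
    ¬ (Σ (BF n) λ f → NonLinear f × NearlyBent q f)
corollary1 (suc zero) (s≤s ())
corollary1 (suc (suc m)) 2<n 2∣n q q-balanced (f , _ , f-balanced , W≤ρ) with 2^n≡[4b]² 2<n 2∣n
... | b , 2^n≡t² , 1≤b =
  ¬walsh²≤2^n q f ∑q≡0 ∑f≡0 (nearlyBent⇒walsh²≤2^n q f b 2^n≡t² 1≤b ∑q≡0 ∑f≡0 W≤ρ)
  where
  ∑q≡0 = balanced⇒∑sign≡0 q q-balanced
  ∑f≡0 = balanced⇒∑sign≡0 f f-balanced
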